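{- Let $\mathcal{I}_n$ be the subposet of the middle order $\mathcal{P}_n$ consisting of the involutions of size $n$ (with the induced order), and let $\mu$ be its Möbius function. Fix $w\in\mathcal{I}_n$ and let $\alpha$ be the number of nonzero entries of $I(w)$. Then $$\mu(e_n,w)=\begin{cases}(-1)^\alpha & \text{if } w \text{ is slow-climbing},\\ 0 & \text{otherwise.}\end{cases}$$
   Context: $e_n$ is the identity permutation of size $n$. For $w\in S_n$ (one-line notation), its inversion sequence is $I(w)=(x_1,\ldots,x_n)$ with $x_i=\#\{j<i : w^{ -1}(j)>w^{ -1}(i)\}$. The middle order $\mathcal{P}_n$ is the poset on $S_n$ with $v\le w$ iff $I(v)\le I(w)$ coordinate-wise. For an inversion sequence $x$, an index $i$ is an ascent if $x_i<x_{i+1}$, a small ascent if $x_{i+1}=x_i+1$, and a large ascent otherwise; $x$ is slow-climbing if it has no large ascents; a permutation is slow-climbing if its inversion sequence is. The Möbius function of a finite poset is defined by $\mu(s,s)=1$, $\mu(s,u)=-\sum_{s\le t<u}\mu(s,t)$ for $s<u$, and $\mu(s,u)=0$ if $s\not\le u$. -}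

module Defs where

open import Data.Nat using (ℕ; zero; suc; _≤_; _<_; _≤?_; _<?_; _≟_)
open import Data.Fin using (Fin; toℕ)
open import Data.Fin.Properties using (all?) renaming (_≟_ to _≟F_)
open import Data.Integer using (ℤ; 0ℤ; 1ℤ; -_; _+_)
open import Data.List using (List; []; _∷_; map; filter; length; upTo; foldr; concatMap)
open import Data.List.Relation.Binary.Pointwise using (Pointwise)
open import Data.List.Relation.Binary.Pointwise.Properties using (decidable)
open import Data.Vec using (Vec; []; _∷_; lookup; tabulate; toList)
open import Data.Vec.Properties using (≡-dec)
open import Data.Product using (_×_; _,_)
open import Function using (id)
open import Relation.Nullary using (Dec; yes; no; ¬_)
open import Relation.Nullary.Decidable using (_×-dec_; ¬?)
open import Relation.Binary.PropositionalEquality using (_≡_)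
open import Relation.Binary.Definitions using (DecidableEquality)

-- Recursion is on fuel; fuel = length L suffices since every strict
-- chain has fewer than length L steps.

sumℤ : List ℤ → ℤ
sumℤ = foldr _+_ 0ℤ

module FinitePoset {A : Set} (L : List A) (_≟A_ : DecidableEquality A)
                   (_⊑_ : A → A → Set) (_⊑?_ : ∀ x y → Dec (x ⊑ y)) where

  _⊏_ : A → A → Set
  x ⊏ y = x ⊑ y × ¬ (x ≡ y)

  _⊏?_ : ∀ x y → Dec (x ⊏ y)
  x ⊏? y = (x ⊑? y) ×-dec ¬? (x ≟A y)

  mobiusFuel : ℕ → A → A → ℤ
  mobiusFuel zero s u = 0ℤ
  mobiusFuel (suc f) s u with s ≟A u | s ⊑? u
  ... | yes _ | _ = 1ℤ
  ... | no _ | no _ = 0ℤ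
  ... | no _ | yes _ =
    - sumℤ (map (mobiusFuel f s) (filter (λ t → (s ⊑? t) ×-dec (t ⊏? u)) L))

  mobius : A → A → ℤ
  mobius = mobiusFuel (length L)

-- Permutations in one-line notation (positions and values 0-indexed).

Word : ℕ → Set
Word n = Vec (Fin n) n

e : (n : ℕ) → Word n
e n = tabulate id

IsInvolution : ∀ {n} → Word n → Set
IsInvolution {n} w = ∀ (i : Fin n) → lookup w (lookup w i) ≡ i

isInvolution? : ∀ {n} (w : Word n) → Dec (IsInvolution w)
isInvolution? w = all? (λ i → lookup w (lookup w i) ≟F i)

posIn : ℕ → List ℕ → ℕ
posIn j [] = 0
posIn j (x ∷ xs) with x ≟ j
... | yes _ = 0
... | no _ = suc (posIn j xs)

winv : ∀ {n} → Word n → ℕ → ℕ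
winv w j = posIn j (map toℕ (toList w))

I : ∀ {n} → Word n → List ℕ
I {n} w = map (λ i → length (filter (λ j → winv w i <? winv w j) (upTo i))) (upTo n)

_≼_ : ∀ {n} → Word n → Word n → Set
v ≼ w = Pointwise _≤_ (I v) (I w)

_≼?_ : ∀ {n} (v w : Word n) → Dec (v ≼ w)
v ≼? w = decidable _≤?_ (I v) (I w)

allWords : (n k : ℕ) → List (Vec (Fin n) k)
allWords n zero = [] ∷ []
allWords n (suc k) = concatMap (λ v → map (_∷ v) (Data.List.allFin n)) (allWords n k)
  where import Data.List

involutions : (n : ℕ) → List (Word n)
involutions n = filter isInvolution? (allWords n n)

μI : (n : ℕ) → Word n → Word n → ℤ
μI n = FinitePoset.mobius (involutions n) (≡-dec _≟F_) _≼_ _≼?_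

LargeAscent : ℕ → ℕ → Set
LargeAscent x y = x < y × ¬ (y ≡ suc x)

SlowClimbing : List ℕ → Set
SlowClimbing [] = Data.Unit.⊤ where import Data.Unit
SlowClimbing (x ∷ []) = Data.Unit.⊤ where import Data.Unit
SlowClimbing (x ∷ y ∷ xs) = ¬ LargeAscent x y × SlowClimbing (y ∷ xs)

nonzeros : List ℕ → ℕ
nonzeros xs = length (filter (λ x → ¬? (x ≟ 0)) xs)

module Submission where

-- An involution is its own inverse, so its inversion sequence is its code
-- i ↦ #{ j < i ∣ w j > w i }, and the middle order compares codes pointwise. The Möbius
-- function μ(e, ·) is determined by μ(e, e) = 1 and Σ_{e ≤ t ≤ u} μ(e, t) = 0 for u ≠ e, so it
-- suffices to check these sums for the claimed formula. Let k be the last position at which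
-- the code of u is nonzero. A slow-climbing involution t ≤ u fixes everything after a final
-- reversed block [a, b] with b ∈ {k - 1, k}; moving b between k - 1 and k is an involution on
-- these t that changes the number of nonzero code entries by one, hence reverses the sign,
-- and the t that are not slow-climbing contribute 0.

open import Defs
open import Data.Nat using (ℕ)
open import Data.Integer using (ℤ; 0ℤ; -1ℤ; _^_)
open import Data.Product using (_×_)
open import Relation.Nullary using (¬_)
open import Relation.Binary.PropositionalEquality using (_≡_)

open import Data.Bool using (Bool; true; false; not; if_then_else_)
open import Data.Empty using (⊥-elim)
open import Data.Fin using (Fin; toℕ; fromℕ<)
open import Data.Fin.Properties using (toℕ-fromℕ<; fromℕ<-toℕ; toℕ<n; toℕ-injective) renaming (_≟_ to _≟F_)
open import Data.Integer using (1ℤ; -_) renaming (_+_ to _+ℤ_)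
import Data.Integer as ℤ
import Data.Integer.Properties as ℤ
open import Algebra.Properties.AbelianGroup ℤ.+-0-abelianGroup using (inverseˡ-unique)
open import Data.List using (List; []; _∷_; map; filter; length; applyUpTo; upTo; allFin)
open import Data.List.Membership.Propositional using (_∈_)
open import Data.List.Membership.Propositional.Properties
  using ( ∈-map⁺; ∈-map⁻; ∈-filter⁺; ∈-filter⁻; ∈-concatMap⁺; ∈-allFin
        ; ∈-applyUpTo⁺; ∈-applyUpTo⁻; ∈-upTo⁺; ∈-upTo⁻)
open import Data.List.Membership.Propositional.Properties.WithK using (unique∧set⇒bag)
open import Data.List.Properties
  using (map-applyUpTo; map-upTo; map-∘; map-cong-local; filter-notAll; length-map; ∷-injectiveˡ; ∷-injectiveʳ)
open import Data.List.Relation.Binary.BagAndSetEquality using (∼bag⇒↭)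
open import Data.List.Relation.Binary.Disjoint.Propositional using (Disjoint)
open import Data.List.Relation.Binary.Permutation.Propositional using (_↭_; ↭⇒↭ₛ)
import Data.List.Relation.Binary.Permutation.Propositional.Properties as ↭
open import Data.List.Relation.Binary.Permutation.Setoid.Properties using (foldr-commMonoid)
open import Data.List.Relation.Binary.Pointwise using (Pointwise; []; _∷_)
open import Data.List.Relation.Unary.All as All using (All; []; _∷_)
open import Data.List.Relation.Unary.AllPairs as AllPairs using ([]; _∷_)
import Data.List.Relation.Unary.AllPairs.Properties as AllPairs
open import Data.List.Relation.Unary.Any as Any using (here; there)
open import Data.List.Relation.Unary.Unique.Propositional using (Unique)
import Data.List.Relation.Unary.Unique.Propositional.Properties as Unique
open import Data.Nat hiding (_^_)
open import Data.Nat.ListAction using (sum)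
open import Data.Nat.ListAction.Properties using (sum-↭)
open import Data.Nat.Properties
open import Data.Product using (_,_; proj₁; proj₂; ∃)
open import Data.Sum using (_⊎_; inj₁; inj₂)
open import Data.Unit using (tt)
open import Data.Vec using (Vec; []; _∷_; lookup; tabulate; toList)
import Data.Vec.Properties as Vec
open import Function using (_∘_; case_of_)
open import Function.Bundles using (mk⇔)
open import Relation.Binary.Definitions using (DecidableEquality; tri<; tri≈; tri>)
open import Relation.Binary.PropositionalEquality
  using (refl; sym; trans; cong; cong₂; subst; subst₂; _≢_; setoid; module ≡-Reasoning)
open import Relation.Nullary using (Dec; yes; no; does)
open import Relation.Nullary.Decidable using (dec-true; dec-false; _×-dec_; ¬?)

indicator : Bool → ℕ
indicator true  = 1
indicator false = 0

count : (ℕ → Bool) → ℕ → ℕ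
count P zero    = 0
count P (suc n) = indicator (P 0) + count (P ∘ suc) n

count-cong : ∀ {P Q} n → (∀ j → j < n → P j ≡ Q j) → count P n ≡ count Q n
count-cong zero    P≡Q = refl
count-cong (suc n) P≡Q =
  cong₂ _+_ (cong indicator (P≡Q 0 z<s)) (count-cong n (λ j j<n → P≡Q (suc j) (s<s j<n)))

count-suc : ∀ P n → count P (suc n) ≡ count P n + indicator (P n)
count-suc P zero    = +-comm (indicator (P 0)) 0
count-suc P (suc n) = trans (cong (indicator (P 0) +_) (count-suc (P ∘ suc) n))
                            (sym (+-assoc (indicator (P 0)) _ _))

count-+ : ∀ P m n → count P (m + n) ≡ count P m + count (λ j → P (m + j)) n
count-+ P zero    n = refl
count-+ P (suc m) n = trans (cong (indicator (P 0) +_) (count-+ (P ∘ suc) m n))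
                            (sym (+-assoc (indicator (P 0)) _ _))

count-none : ∀ P n → (∀ j → j < n → P j ≡ false) → count P n ≡ 0
count-none P zero    _ = refl
count-none P (suc n) h rewrite h 0 z<s = count-none (P ∘ suc) n (λ j j<n → h (suc j) (s<s j<n))

count-all : ∀ P n → (∀ j → j < n → P j ≡ true) → count P n ≡ n
count-all P zero    _ = refl
count-all P (suc n) h rewrite h 0 z<s = cong suc (count-all (P ∘ suc) n (λ j j<n → h (suc j) (s<s j<n)))

count≤n : ∀ P n → count P n ≤ n
count≤n P zero = z≤n
count≤n P (suc n) with P 0
... | true  = s≤s (count≤n (P ∘ suc) n)
... | false = m≤n⇒m≤1+n (count≤n (P ∘ suc) n)

count-mono : ∀ P Q n → (∀ j → j < n → P j ≡ true → Q j ≡ true) → count P n ≤ count Q n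
count-mono P Q zero    _   = z≤n
count-mono P Q (suc n) P⇒Q with P 0 in P0 | Q 0 in Q0
... | true  | true  = s≤s (count-mono (P ∘ suc) (Q ∘ suc) n (λ j j<n → P⇒Q (suc j) (s<s j<n)))
... | false | true  = m≤n⇒m≤1+n (count-mono (P ∘ suc) (Q ∘ suc) n (λ j j<n → P⇒Q (suc j) (s<s j<n)))
... | false | false = count-mono (P ∘ suc) (Q ∘ suc) n (λ j j<n → P⇒Q (suc j) (s<s j<n))
... | true  | false with () ← trans (sym Q0) (P⇒Q 0 z<s P0)

count-mono-< : ∀ P Q n → (∀ j → j < n → P j ≡ true → Q j ≡ true) →
               ∀ k → k < n → P k ≡ false → Q k ≡ true → count P n < count Q n
count-mono-< P Q (suc n) P⇒Q zero _ Pk Qk rewrite Pk | Qk =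
  s≤s (count-mono (P ∘ suc) (Q ∘ suc) n (λ j j<n → P⇒Q (suc j) (s<s j<n)))
count-mono-< P Q (suc n) P⇒Q (suc k) (s≤s k<n) Pk Qk with P 0 in P0 | Q 0 in Q0
... | true  | true  = s≤s (count-mono-< (P ∘ suc) (Q ∘ suc) n (λ j j<n → P⇒Q (suc j) (s<s j<n)) k k<n Pk Qk)
... | false | true  = m≤n⇒m≤1+n (count-mono-< (P ∘ suc) (Q ∘ suc) n (λ j j<n → P⇒Q (suc j) (s<s j<n)) k k<n Pk Qk)
... | false | false = count-mono-< (P ∘ suc) (Q ∘ suc) n (λ j j<n → P⇒Q (suc j) (s<s j<n)) k k<n Pk Qk
... | true  | false with () ← trans (sym Q0) (P⇒Q 0 z<s P0)

count-pos : ∀ P n k → k < n → P k ≡ true → 0 < count P n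
count-pos P n k k<n Pk = subst (_< count P n) (count-none _ n (λ _ _ → refl))
  (count-mono-< (λ _ → false) P n (λ _ _ ()) k k<n refl Pk)

count≡0⇒ : ∀ P n → count P n ≡ 0 → ∀ j → j < n → P j ≡ false
count≡0⇒ P n count≡0 j j<n with P j in Pj
... | false = refl
... | true with () ← subst (0 <_) count≡0 (count-pos P n j j<n Pj)

count-update : ∀ P Q n p → p < n → (∀ j → j < n → j ≢ p → P j ≡ Q j) →
               count P n + indicator (Q p) ≡ count Q n + indicator (P p)
count-update P Q (suc n) zero _ P≡Q
  rewrite count-cong {P ∘ suc} {Q ∘ suc} n (λ j j<n → P≡Q (suc j) (s<s j<n) (λ ()))
  = exchange (indicator (P 0)) (indicator (Q 0)) (count (Q ∘ suc) n)
  where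
  exchange : ∀ a b c → a + c + b ≡ b + c + a
  exchange a b c = trans (+-comm (a + c) b) (trans (cong (b +_) (+-comm a c)) (sym (+-assoc b c a)))
count-update P Q (suc n) (suc p) (s≤s p<n) P≡Q rewrite P≡Q 0 z<s (λ ()) = begin
  indicator (Q 0) + count (P ∘ suc) n + indicator (Q (suc p))
    ≡⟨ +-assoc (indicator (Q 0)) _ _ ⟩
  indicator (Q 0) + (count (P ∘ suc) n + indicator (Q (suc p)))
    ≡⟨ cong (indicator (Q 0) +_) (count-update (P ∘ suc) (Q ∘ suc) n p p<n
         (λ j j<n j≢p → P≡Q (suc j) (s<s j<n) (j≢p ∘ suc-injective))) ⟩
  indicator (Q 0) + (count (Q ∘ suc) n + indicator (P (suc p)))
    ≡⟨ +-assoc (indicator (Q 0)) _ _ ⟨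
  indicator (Q 0) + count (Q ∘ suc) n + indicator (P (suc p)) ∎
  where open ≡-Reasoning

count-> : ∀ q n → count (λ j → does (q <? j)) n ≡ n ∸ suc q
count-> q zero = refl
count-> q (suc n) rewrite count-suc (λ j → does (q <? j)) n | count-> q n with q <? n
... | yes q<n rewrite dec-true (q <? n) q<n = trans (+-comm _ 1) (sym (+-∸-assoc 1 q<n))
... | no q≮n  rewrite dec-false (q <? n) q≮n = trans (+-identityʳ _)
                  (trans (m≤n⇒m∸n≡0 (m≤n⇒m≤1+n (≮⇒≥ q≮n))) (sym (m≤n⇒m∸n≡0 (≮⇒≥ q≮n))))

count-< : ∀ q n → q ≤ n → count (λ j → does (j <? q)) n ≡ q
count-< q zero z≤n = refl
count-< q (suc n) q≤1+n rewrite count-suc (λ j → does (j <? q)) n with n <? q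
... | yes n<q rewrite dec-true (n <? q) n<q = trans (cong (_+ 1) (count-all _ n (λ j j<n → dec-true (j <? q) (<-trans j<n n<q))))
                      (trans (+-comm _ 1) (≤-antisym n<q q≤1+n))
... | no n≮q  rewrite dec-false (n <? q) n≮q = trans (+-identityʳ _) (count-< q n (≮⇒≥ n≮q))

count≡sum : ∀ P n → count P n ≡ sum (applyUpTo (indicator ∘ P) n)
count≡sum P zero    = refl
count≡sum P (suc n) = cong (indicator (P 0) +_) (count≡sum (P ∘ suc) n)

-- Involutions of [0, n) and their codes

-- only the values of f on [0, n) are constrained
Involution : ℕ → (ℕ → ℕ) → Set
Involution n f = ∀ i → i < n → f i < n × f (f i) ≡ i

Involution-injective : ∀ {n f} → Involution n f → ∀ {i j} → i < n → j < n → f i ≡ f j → i ≡ j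
Involution-injective {f = f} inv {i} {j} i<n j<n fi≡fj =
  trans (sym (proj₂ (inv i i<n))) (trans (cong f fi≡fj) (proj₂ (inv j j<n)))

applyUpTo-↭-upTo : ∀ {n f} → Involution n f → applyUpTo f n ↭ upTo n
applyUpTo-↭-upTo {n} {f} inv =
  ∼bag⇒↭ (unique∧set⇒bag (Unique.applyUpTo⁺₁ f n distinct) (Unique.upTo⁺ n) (mk⇔ to from))
  where
  distinct : ∀ {i j} → i < j → j < n → f i ≢ f j
  distinct i<j j<n fi≡fj = <⇒≢ i<j (Involution-injective inv (<-trans i<j j<n) j<n fi≡fj)
  to : ∀ {x} → x ∈ applyUpTo f n → x ∈ upTo n
  to x∈ with i , i<n , refl ← ∈-applyUpTo⁻ f x∈ = ∈-upTo⁺ (proj₁ (inv i i<n))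
  from : ∀ {x} → x ∈ upTo n → x ∈ applyUpTo f n
  from {x} x∈ = let x<n = ∈-upTo⁻ x∈ in
    subst (_∈ applyUpTo f n) (proj₂ (inv x x<n)) (∈-applyUpTo⁺ f (proj₁ (inv x x<n)))

count-∘-involution : ∀ {n f} → Involution n f → ∀ P → count (P ∘ f) n ≡ count P n
count-∘-involution {n} {f} inv P = begin
  count (P ∘ f) n                             ≡⟨ count≡sum (P ∘ f) n ⟩
  sum (applyUpTo (indicator ∘ P ∘ f) n)       ≡⟨ cong sum (map-applyUpTo f (indicator ∘ P) n) ⟨
  sum (map (indicator ∘ P) (applyUpTo f n))   ≡⟨ sum-↭ (↭.map⁺ (indicator ∘ P) (applyUpTo-↭-upTo inv)) ⟩
  sum (map (indicator ∘ P) (upTo n))          ≡⟨ cong sum (map-upTo (indicator ∘ P) n) ⟩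
  sum (applyUpTo (indicator ∘ P) n)           ≡⟨ count≡sum P n ⟨
  count P n                                   ∎
  where open ≡-Reasoning

does-true⇒ : ∀ {A : Set} (d : Dec A) → does d ≡ true → A
does-true⇒ (yes a) _ = a

does-false⇒ : ∀ {A : Set} (d : Dec A) → does d ≡ false → ¬ A
does-false⇒ (no ¬a) _ = ¬a

<ᵇ-flip : ∀ x y → x ≢ y → does (x <? y) ≡ not (does (y <? x))
<ᵇ-flip x y x≢y with <-cmp x y
... | tri< x<y _ y≮x rewrite dec-true (x <? y) x<y | dec-false (y <? x) y≮x = refl
... | tri≈ _ x≡y _   = ⊥-elim (x≢y x≡y)
... | tri> x≮y _ y<x rewrite dec-false (x <? y) x≮y | dec-true (y <? x) y<x = refl

<ᵇ-irrefl : ∀ x → does (x <? x) ≡ false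
<ᵇ-irrefl x = dec-false (x <? x) (<-irrefl refl)

-- for an involution f = f⁻¹, the i-th entry of the inversion sequence
code : (ℕ → ℕ) → ℕ → ℕ
code f i = count (λ j → does (f i <? f j)) i

code-cong : ∀ f g i → (∀ j → j ≤ i → f j ≡ g j) → code f i ≡ code g i
code-cong f g i f≡g = count-cong i (λ j j<i → cong₂ (λ x y → does (x <? y)) (f≡g i ≤-refl) (f≡g j (<⇒≤ j<i)))

SameOrderBelow : (f g : ℕ → ℕ) → ℕ → Set
SameOrderBelow f g i = ∀ j j' → j < i → j' < i → does (f j <? f j') ≡ does (g j <? g j')

-- If f and g order [0, i) alike, the set counted by the code at i is upward closed in
-- that common order, so equal codes force the same comparisons with position i.
same-code⇒above : ∀ {n f g i} → Involution n f → i < n → SameOrderBelow f g i →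
  code f i ≡ code g i → ∀ j → j < i → does (f i <? f j) ≡ true → does (g i <? g j) ≡ true
same-code⇒above {n} {f} {g} {i} invf i<n same f≡g j j<i fj with does (g i <? g j) in gj
... | true  = refl
... | false = ⊥-elim (<-irrefl (sym f≡g) (count-mono-< _ _ i g⇒f j j<i gj fj))
  where
  g⇒f : ∀ j' → j' < i → does (g i <? g j') ≡ true → does (f i <? f j') ≡ true
  g⇒f j' j'<i gj' with <-cmp (f j) (f j')
  ... | tri< fj<fj' _ _ = dec-true (f i <? f j') (<-trans (does-true⇒ (f i <? f j) fj) fj<fj')
  ... | tri≈ _ fj≡fj' _ with refl ← Involution-injective invf (<-trans j<i i<n) (<-trans j'<i i<n) fj≡fj'
    with () ← trans (sym gj) gj'
  ... | tri> _ _ fj'<fj = ⊥-elim (does-false⇒ (g i <? g j) gj (<-trans (does-true⇒ (g i <? g j') gj')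
          (does-true⇒ (g j' <? g j) (trans (sym (same j' j j'<i j<i)) (dec-true (f j' <? f j) fj'<fj)))))

same-code⇒same-order-with : ∀ {n f g i} → Involution n f → Involution n g → i < n →
  SameOrderBelow f g i → code f i ≡ code g i → ∀ j → j < i → does (f i <? f j) ≡ does (g i <? g j)
same-code⇒same-order-with {n} {f} {g} {i} invf invg i<n same f≡g j j<i
  with does (f i <? f j) in fj | does (g i <? g j) in gj
... | true  | true  = refl
... | false | false = refl
... | true  | false with () ← trans (sym gj) (same-code⇒above {g = g} invf i<n same f≡g j j<i fj)
... | false | true  with () ← trans (sym fj)
      (same-code⇒above {g = f} invg i<n (λ a b a< b< → sym (same a b a< b<)) (sym f≡g) j j<i gj)

same-code⇒same-order : ∀ {n f g} → Involution n f → Involution n g →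
  (∀ i → i < n → code f i ≡ code g i) → ∀ i → i ≤ n → SameOrderBelow f g i
same-code⇒same-order invf invg f≡g zero _ j j' ()
same-code⇒same-order {f = f} {g} invf invg f≡g (suc i) i<n j j' j<1+i j'<1+i
  with same-code⇒same-order invf invg f≡g i (<⇒≤ i<n) | j ≟ i | j' ≟ i
... | _    | yes refl | yes refl = trans (<ᵇ-irrefl (f j)) (sym (<ᵇ-irrefl (g j)))
... | same | yes refl | no j'≢i  =
  same-code⇒same-order-with invf invg i<n same (f≡g i i<n) j' (≤∧≢⇒< (≤-pred j'<1+i) j'≢i)
... | same | no j≢i   | yes refl =
  let j<i = ≤∧≢⇒< (≤-pred j<1+i) j≢i
      fj≢fi fj≡fi = j≢i (Involution-injective invf (<-trans j<i i<n) i<n fj≡fi)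
      gj≢gi gj≡gi = j≢i (Involution-injective invg (<-trans j<i i<n) i<n gj≡gi)
  in trans (<ᵇ-flip (f j) (f j') fj≢fi)
       (trans (cong not (same-code⇒same-order-with invf invg i<n same (f≡g i i<n) j j<i))
         (sym (<ᵇ-flip (g j) (g j') gj≢gi)))
... | same | no j≢i   | no j'≢i  = same j j' (≤∧≢⇒< (≤-pred j<1+i) j≢i) (≤∧≢⇒< (≤-pred j'<1+i) j'≢i)

value≡rank : ∀ {n f} → Involution n f → ∀ i → i < n → f i ≡ count (λ j → does (f j <? f i)) n
value≡rank {n} {f} inv i i<n = trans (sym (count-< (f i) n (<⇒≤ (proj₁ (inv i i<n)))))
  (sym (count-∘-involution inv (λ x → does (x <? f i))))

code-injective : ∀ {n f g} → Involution n f → Involution n g →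
  (∀ i → i < n → code f i ≡ code g i) → ∀ i → i < n → f i ≡ g i
code-injective {n} {f} {g} invf invg f≡g i i<n = begin
  f i                                   ≡⟨ value≡rank invf i i<n ⟩
  count (λ j → does (f j <? f i)) n     ≡⟨ count-cong n (λ j j<n → same j i j<n i<n) ⟩
  count (λ j → does (g j <? g i)) n     ≡⟨ value≡rank invg i i<n ⟨
  g i                                   ∎
  where
  open ≡-Reasoning
  same = same-code⇒same-order invf invg f≡g n ≤-refl

-- Slow-climbing involutions end in a reversed block

FixesAbove : ℕ → ℕ → (ℕ → ℕ) → Set
FixesAbove K n f = ∀ j → K < j → j < n → f j ≡ j

Involution-restrict : ∀ {n K f} → Involution n f → FixesAbove K n f → K < n → Involution (suc K) f
Involution-restrict {n} {K} {f} inv fixed K<n i i≤K with f i ≤? K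
... | yes fi≤K = s≤s fi≤K , proj₂ (inv i (≤-<-trans (≤-pred i≤K) K<n))
... | no  fi≰K = ⊥-elim (fi≰K (subst (_≤ K) (sym fi≡i) (≤-pred i≤K)))
  where
  i<n = ≤-<-trans (≤-pred i≤K) K<n
  fi≡i : f i ≡ i
  fi≡i = trans (sym (fixed (f i) (≰⇒> fi≰K) (proj₁ (inv i i<n)))) (proj₂ (inv i i<n))

FixesAbove⇒≤ : ∀ {n K f} → Involution n f → FixesAbove K n f → K < n → ∀ i → i ≤ K → f i ≤ K
FixesAbove⇒≤ inv fixed K<n i i≤K = ≤-pred (proj₁ (Involution-restrict inv fixed K<n i (s≤s i≤K)))

code≡0⇒ : ∀ f i → code f i ≡ 0 → ∀ j → j < i → ¬ (f i < f j)
code≡0⇒ f i code≡0 j j<i = does-false⇒ (f i <? f j) (count≡0⇒ _ i code≡0 j j<i)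

codes≡0⇒FixesAbove : ∀ {n K f} → Involution n f → (∀ j → K < j → j < n → code f j ≡ 0) → FixesAbove K n f
codes≡0⇒FixesAbove {n} {K} {f} inv code≡0 j K<j j<n = fixedFrom (n ∸ j) j K<j j<n ≤-refl
  where
  fixedFrom : ∀ m j → K < j → j < n → n ∸ j ≤ m → f j ≡ j
  fixedFrom zero j K<j j<n n∸j≤0 = ⊥-elim (<-irrefl refl (<-≤-trans (m<n⇒0<n∸m j<n) n∸j≤0))
  fixedFrom (suc m) j K<j j<n n∸j≤1+m with <-cmp (f j) j
  ... | tri≈ _ fj≡j _ = fj≡j
  ... | tri< fj<j _ _ = ⊥-elim (code≡0⇒ f j (code≡0 j K<j j<n) (f j) fj<j
                          (subst (f j <_) (sym (proj₂ (inv j j<n))) fj<j))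
  ... | tri> _ _ j<fj = ⊥-elim (<-irrefl (trans (sym (proj₂ (inv j j<n))) ffj≡fj) j<fj)
    where
    fj<n = proj₁ (inv j j<n)
    ffj≡fj = fixedFrom m (f j) (<-trans K<j j<fj) fj<n
               (≤-pred (≤-trans (∸-monoʳ-< j<fj (<⇒≤ fj<n)) n∸j≤1+m))

code-pos⇒partner< : ∀ {n K f} → Involution n f → FixesAbove K n f → K < n → 0 < code f K → f K < K
code-pos⇒partner< {n} {K} {f} inv fixed K<n 0<code = ≤∧≢⇒< (FixesAbove⇒≤ inv fixed K<n K ≤-refl) fK≢K
  where
  fK≢K : f K ≢ K
  fK≢K fK≡K = <-irrefl refl (≤-trans 0<code (≤-reflexive (count-none _ K (λ j j<K →
    dec-false (f K <? f j) (λ fK<fj → <-irrefl refl (<-≤-trans (subst (_< f j) fK≡K fK<fj)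
      (FixesAbove⇒≤ inv fixed K<n j (<⇒≤ j<K))))))))

code-partner≡0 : ∀ {n K f} → Involution n f → FixesAbove K n f → K < n → f K < K → code f (f K) ≡ 0
code-partner≡0 {n} {K} {f} inv fixed K<n fK<K = count-none _ (f K) (λ j j<fK →
  dec-false (f (f K) <? f j) (λ ffK<fj → <-irrefl refl (<-≤-trans (subst (_< f j) (proj₂ (inv K K<n)) ffK<fj)
    (FixesAbove⇒≤ inv fixed K<n j (<⇒≤ (<-trans j<fK fK<K))))))

code-top : ∀ {n K f} → Involution n f → FixesAbove K n f → K < n → code f K ≡ K ∸ f K
code-top {n} {K} {f} inv fixed K<n = begin
  code f K                                     ≡⟨ +-identityʳ _ ⟨
  code f K + 0                                 ≡⟨ cong (λ b → code f K + indicator b) (<ᵇ-irrefl (f K)) ⟨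
  code f K + indicator (does (f K <? f K))     ≡⟨ count-suc (λ j → does (f K <? f j)) K ⟨
  count (λ j → does (f K <? f j)) (suc K)     ≡⟨ count-∘-involution (Involution-restrict inv fixed K<n)
                                                    (λ x → does (f K <? x)) ⟩
  count (λ j → does (f K <? j)) (suc K)       ≡⟨ count-> (f K) (suc K) ⟩
  K ∸ f K                                      ∎
  where open ≡-Reasoning

slow-growth : ∀ (c : ℕ → ℕ) K → (∀ j → j < K → c (suc j) ≤ suc (c j)) →
              ∀ i d → i + d ≤ K → c (i + d) ≤ c i + d
slow-growth c K slow i zero _ = ≤-reflexive (trans (cong c (+-identityʳ i)) (sym (+-identityʳ _)))
slow-growth c K slow i (suc d) i+1+d≤K = begin
  c (i + suc d)    ≡⟨ cong c (+-suc i d) ⟩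
  c (suc (i + d))  ≤⟨ slow (i + d) i+d<K ⟩
  suc (c (i + d))  ≤⟨ s≤s (slow-growth c K slow i d (<⇒≤ i+d<K)) ⟩
  suc (c i + d)    ≡⟨ +-suc (c i) d ⟨
  c i + suc d      ∎
  where
  open ≤-Reasoning
  i+d<K = subst (_≤ K) (+-suc i d) i+1+d≤K

-- The code at K of an involution fixing everything above K is K - f K, and the code at
-- f K is 0; slow growth then pins every code on [f K, K] down from above and below.
code-on-block : ∀ {n K f} → Involution n f → FixesAbove K n f → K < n →
  (∀ j → j < K → code f (suc j) ≤ suc (code f j)) →
  ∀ i → K ∸ code f K ≤ i → i ≤ K → code f i ≡ i ∸ (K ∸ code f K)
code-on-block {n} {K} {f} inv fixed K<n slow i a≤i i≤K with code f K ≟ 0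
... | yes code≡0 rewrite code≡0 with refl ← ≤-antisym i≤K a≤i = trans code≡0 (sym (n∸n≡0 i))
... | no  code≢0 = trans (≤-antisym upper lower) (cong (i ∸_) (sym a≡m))
  where
  m  = f K
  m<K = code-pos⇒partner< inv fixed K<n (n≢0⇒n>0 code≢0)
  a≡m : K ∸ code f K ≡ m
  a≡m = trans (cong (K ∸_) (code-top inv fixed K<n)) (m∸[m∸n]≡n (<⇒≤ m<K))
  m≤i = subst (_≤ i) a≡m a≤i
  d = i ∸ m
  r = K ∸ i
  m+d≡i : m + d ≡ i
  m+d≡i = m+[n∸m]≡n m≤i
  i+r≡K : i + r ≡ K
  i+r≡K = m+[n∸m]≡n i≤K
  upper : code f i ≤ d
  upper = subst (λ x → code f x ≤ d) m+d≡i
    (≤-trans (slow-growth (code f) K slow m d (subst (_≤ K) (sym m+d≡i) i≤K))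
             (≤-reflexive (cong (_+ d) (code-partner≡0 inv fixed K<n m<K))))
  codeK≡d+r : code f K ≡ d + r
  codeK≡d+r = trans (code-top inv fixed K<n)
    (trans (cong (_∸ m) (sym (trans (sym (+-assoc m d r)) (trans (cong (_+ r) m+d≡i) i+r≡K))))
           (m+n∸m≡n m (d + r)))
  lower : d ≤ code f i
  lower = +-cancelʳ-≤ r d (code f i) (≤-trans (≤-reflexive (sym codeK≡d+r))
    (subst (λ x → code f x ≤ code f i + r) i+r≡K (slow-growth (code f) K slow i r (≤-reflexive i+r≡K))))

partner-top : ∀ {n K f a} → Involution n f → FixesAbove K n f → K < n → a ≤ K → code f K ≡ K ∸ a → f K ≡ a
partner-top inv fixed K<n a≤K code≡ =
  ∸-cancelˡ-≡ (FixesAbove⇒≤ inv fixed K<n _ ≤-refl) a≤K (trans (sym (code-top inv fixed K<n)) code≡)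

fixEnds : ℕ → ℕ → (ℕ → ℕ) → ℕ → ℕ
fixEnds a b f j = if does (j ≟ a) then a else if does (j ≟ b) then b else f j

fixEnds-left : ∀ a b f → fixEnds a b f a ≡ a
fixEnds-left a b f rewrite dec-true (a ≟ a) refl = refl

fixEnds-right : ∀ a b f → a ≢ b → fixEnds a b f b ≡ b
fixEnds-right a b f a≢b rewrite dec-false (b ≟ a) (a≢b ∘ sym) | dec-true (b ≟ b) refl = refl

fixEnds-inside : ∀ a b f j → j ≢ a → j ≢ b → fixEnds a b f j ≡ f j
fixEnds-inside a b f j j≢a j≢b rewrite dec-false (j ≟ a) j≢a | dec-false (j ≟ b) j≢b = refl

-- An involution fixing everything above b = suc c, with codes i - a on [a, b], pairs
-- a with b; fixing both ends gives the same situation on the smaller block [a + 1, c].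
module BlockStep {n a c f} (inv : Involution n f) (fixed : FixesAbove (suc c) n f) (b<n : suc c < n)
                 (fb≡a : f (suc c) ≡ a) (codes : ∀ i → a ≤ i → i ≤ suc c → code f i ≡ i ∸ a) where

  b : ℕ
  b = suc c

  fa≡b : f a ≡ b
  fa≡b = trans (cong f (sym fb≡a)) (proj₂ (inv b b<n))

  -- Were f i < a, position i would see f i < f j for j = f i and for all of [a, i).
  partner-above : ∀ i → a < i → i < b → (∀ i' → a < i' → i' < i → a < f i') → a < f i
  partner-above i a<i i<b above with <-cmp (f i) a
  ... | tri> _ _ a<fi = a<fi
  ... | tri≈ _ fi≡a _ = ⊥-elim (<-irrefl (trans (sym (proj₂ (inv i i<n))) (trans (cong f fi≡a) fa≡b)) i<b)
    where i<n = <-trans i<b b<n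
  ... | tri< fi<a _ _ = ⊥-elim (<-irrefl refl (≤-trans tooMany (≤-reflexive (codes i (<⇒≤ a<i) (<⇒≤ i<b)))))
    where
    i<n = <-trans i<b b<n
    P : ℕ → Bool
    P j = does (f i <? f j)
    a+[i∸a]≡i : a + (i ∸ a) ≡ i
    a+[i∸a]≡i = m+[n∸m]≡n (<⇒≤ a<i)
    aboveFi : ∀ j → j < i ∸ a → f i < f (a + j)
    aboveFi zero    _ = subst (f i <_) (sym (trans (cong f (+-identityʳ a)) fa≡b)) (<-trans fi<a (<-trans a<i i<b))
    aboveFi (suc j) j<i∸a = <-trans fi<a (above (a + suc j) (m<m+n a z<s)
                              (subst (a + suc j <_) a+[i∸a]≡i (+-monoʳ-< a j<i∸a)))
    firstPart : 0 < count P a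
    firstPart = count-pos P a (f i) fi<a
      (dec-true (f i <? f (f i)) (subst (f i <_) (sym (proj₂ (inv i i<n))) (<-trans fi<a a<i)))
    tooMany : suc (i ∸ a) ≤ code f i
    tooMany = subst (λ x → suc (i ∸ a) ≤ count P x) a+[i∸a]≡i
      (subst (suc (i ∸ a) ≤_) (sym (count-+ P a (i ∸ a)))
        (subst (λ x → suc (i ∸ a) ≤ count P a + x) (sym (count-all _ (i ∸ a) (λ j j<i∸a →
          dec-true (f i <? f (a + j)) (aboveFi j j<i∸a))))
          (+-monoˡ-≤ (i ∸ a) firstPart)))

  inside-above : ∀ i → a < i → i < b → a < f i
  inside-above i = go i i ≤-refl
    where
    go : ∀ m i → i ≤ m → a < i → i < b → a < f i
    go zero    i i≤0 a<i _ = ⊥-elim (<-irrefl refl (<-≤-trans a<i (≤-trans i≤0 z≤n)))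
    go (suc m) i i≤1+m a<i i<b with i ≤? m
    ... | yes i≤m = go m i i≤m a<i i<b
    ... | no  _   = partner-above i a<i i<b (λ i' a<i' i'<i →
                      go m i' (≤-pred (≤-trans i'<i i≤1+m)) a<i' (<-trans i'<i i<b))

  module _ (a<b : a < b) where

    a≢b : a ≢ b
    a≢b = <⇒≢ a<b

    inner-involution : Involution n (fixEnds a b f)
    inner-involution j j<n with j ≟ a | j ≟ b
    ... | yes refl | _ = subst (_< n) (sym (fixEnds-left a b f)) j<n
                       , trans (cong (fixEnds a b f) (fixEnds-left a b f)) (fixEnds-left a b f)
    ... | no _ | yes refl = subst (_< n) (sym (fixEnds-right a b f a≢b)) j<n
                          , trans (cong (fixEnds a b f) (fixEnds-right a b f a≢b)) (fixEnds-right a b f a≢b)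
    ... | no j≢a | no j≢b =
      subst (_< n) (sym (fixEnds-inside a b f j j≢a j≢b)) (proj₁ (inv j j<n))
      , trans (cong (fixEnds a b f) (fixEnds-inside a b f j j≢a j≢b))
          (trans (fixEnds-inside a b f (f j) fj≢a fj≢b) (proj₂ (inv j j<n)))
      where
      fj≢a : f j ≢ a
      fj≢a fj≡a = j≢b (trans (sym (proj₂ (inv j j<n))) (trans (cong f fj≡a) fa≡b))
      fj≢b : f j ≢ b
      fj≢b fj≡b = j≢a (trans (sym (proj₂ (inv j j<n))) (trans (cong f fj≡b) fb≡a))

    inner-fixesAbove : FixesAbove c n (fixEnds a b f)
    inner-fixesAbove j c<j j<n with j ≟ b
    ... | yes refl = fixEnds-right a b f a≢b
    ... | no  j≢b  = trans (fixEnds-inside a b f j (>⇒≢ (<-trans a<b b<j)) j≢b) (fixed j b<j j<n)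
      where b<j = ≤∧≢⇒< c<j (j≢b ∘ sym)

    -- Fixing a removes exactly one larger value, f a = b, from below each interior position.
    inner-codes : ∀ i → suc a ≤ i → i ≤ c → code (fixEnds a b f) i ≡ i ∸ suc a
    inner-codes i a<i i≤c = +-cancelʳ-≡ 1 _ _ (begin
      code f' i + 1                 ≡⟨ cong (λ x → code f' i + indicator x) Ba ⟨
      code f' i + indicator (B a)   ≡⟨ count-update A B i a a<i agree ⟩
      code f i + indicator (A a)    ≡⟨ cong (λ x → code f i + indicator x) Aa ⟩
      code f i + 0                  ≡⟨ +-identityʳ _ ⟩
      code f i                      ≡⟨ codes i (<⇒≤ a<i) (<⇒≤ i<b) ⟩
      i ∸ a                         ≡⟨ +-∸-assoc 1 a<i ⟩
      1 + (i ∸ suc a)               ≡⟨ +-comm 1 _ ⟩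
      i ∸ suc a + 1                 ∎)
      where
      open ≡-Reasoning
      f' = fixEnds a b f
      i<b = s≤s i≤c
      A B : ℕ → Bool
      A j = does (f' i <? f' j)
      B j = does (f i <? f j)
      f'i≡fi : f' i ≡ f i
      f'i≡fi = fixEnds-inside a b f i (>⇒≢ a<i) (<⇒≢ i<b)
      agree : ∀ j → j < i → j ≢ a → A j ≡ B j
      agree j j<i j≢a rewrite f'i≡fi | fixEnds-inside a b f j j≢a (<⇒≢ (<-trans j<i i<b)) = refl
      Aa : A a ≡ false
      Aa rewrite f'i≡fi | fixEnds-left a b f = dec-false (f i <? a) (<-asym (inside-above i a<i i<b))
      Ba : B a ≡ true
      Ba rewrite fa≡b = dec-true (f i <? b) (≤∧≢⇒< (FixesAbove⇒≤ inv fixed b<n i (<⇒≤ i<b))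
        (λ fi≡b → >⇒≢ a<i (trans (sym (proj₂ (inv i (<-trans i<b b<n)))) (trans (cong f fi≡b) fb≡a))))

reverses-block : ∀ d {n f a b} → b ≡ a + d → Involution n f → FixesAbove b n f → b < n →
  (∀ i → a ≤ i → i ≤ b → code f i ≡ i ∸ a) → ∀ i → a ≤ i → i ≤ b → f i ≡ a + b ∸ i

reverses-block-inside : ∀ d {n f a b} → b ≡ a + d → Involution n f → FixesAbove b n f → b < n →
  (∀ i → a ≤ i → i ≤ b → code f i ≡ i ∸ a) → ∀ i → a < i → i < b → f i ≡ a + b ∸ i

reverses-block d {n} {f} {a} {b} b≡a+d inv fixed b<n codes i a≤i i≤b
  with m≤n⇒m<n∨m≡n a≤i | m≤n⇒m<n∨m≡n i≤b
... | inj₂ refl | _         = trans fa≡b (sym (m+n∸m≡n a b))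
  where
  fb≡a = partner-top inv fixed b<n (≤-trans a≤i i≤b) (codes b (≤-trans a≤i i≤b) ≤-refl)
  fa≡b = trans (cong f (sym fb≡a)) (proj₂ (inv b b<n))
... | inj₁ _    | inj₂ refl = trans fb≡a (sym (m+n∸n≡m a b))
  where fb≡a = partner-top inv fixed b<n a≤i (codes b a≤i ≤-refl)
... | inj₁ a<i  | inj₁ i<b  = reverses-block-inside d b≡a+d inv fixed b<n codes i a<i i<b

reverses-block-inside zero {a = a} b≡a inv fixed b<n codes i a<i i<b =
  ⊥-elim (<-irrefl refl (subst (a <_) (trans b≡a (+-identityʳ a)) (<-trans a<i i<b)))
reverses-block-inside (suc zero) {a = a} b≡a+1 inv fixed b<n codes i a<i i<b =
  ⊥-elim (<⇒≱ a<i (≤-pred (subst (i <_) (trans b≡a+1 (+-comm a 1)) i<b)))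
reverses-block-inside (suc (suc d)) {f = f} {b = suc c} b≡a+d+2 inv fixed b<n codes i a<i i<b =
  trans (sym (fixEnds-inside _ _ f i (>⇒≢ a<i) (<⇒≢ i<b)))
    (trans (reverses-block d c≡a+1+d (Step.inner-involution a<b) (Step.inner-fixesAbove a<b)
              (<-trans (n<1+n c) b<n) (Step.inner-codes a<b) i a<i (≤-pred i<b))
           (cong (_∸ i) (sym (+-suc _ c))))
  where
  a≤b = <⇒≤ (<-trans a<i i<b)
  a<b = <-trans a<i i<b
  module Step = BlockStep inv fixed b<n (partner-top inv fixed b<n a≤b (codes _ a≤b ≤-refl)) codes
  c≡a+1+d = trans (suc-injective (trans b≡a+d+2 (+-suc _ (suc d)))) (+-suc _ d)

-- If f lies below u in the middle order and is the reversal of [a, k] near k, then the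
-- partner m = u k < k has code u m = 0 ≥ code f m, which forces m ≤ a.
block-code≤ : ∀ {n k u} → Involution n u → (∀ j → k < j → j < n → code u j ≡ 0) → k < n → 0 < code u k →
  ∀ (c : ℕ → ℕ) a → a < k → (∀ i → a ≤ i → i < k → c i ≡ i ∸ a) → (∀ i → i < n → c i ≤ code u i) →
  k ∸ a ≤ code u k
block-code≤ {n} {k} {u} inv codes≡0 k<n 0<code c a a<k c≡ c≤ =
  subst (k ∸ a ≤_) (sym (code-top inv fixed k<n)) (∸-monoʳ-≤ k m≤a)
  where
  fixed = codes≡0⇒FixesAbove inv codes≡0
  m = u k
  m<k = code-pos⇒partner< inv fixed k<n 0<code
  m≤a : m ≤ a
  m≤a with m ≤? a
  ... | yes m≤a = m≤a
  ... | no  m≰a = ⊥-elim (<-irrefl refl (begin-strict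
    0            <⟨ m<n⇒0<n∸m (≰⇒> m≰a) ⟩
    m ∸ a        ≡⟨ c≡ m (<⇒≤ (≰⇒> m≰a)) m<k ⟨
    c m          ≤⟨ c≤ m (<-trans m<k k<n) ⟩
    code u m     ≡⟨ code-partner≡0 inv fixed k<n m<k ⟩
    0            ∎))
    where open ≤-Reasoning

mirror-≥ : ∀ a b i → i ≤ b → a ≤ a + b ∸ i
mirror-≥ a b i i≤b = subst (a ≤_) (sym (+-∸-assoc a i≤b)) (m≤m+n a (b ∸ i))

mirror-≤ : ∀ a b i → a ≤ i → a + b ∸ i ≤ b
mirror-≤ a b i a≤i = ≤-trans (∸-monoʳ-≤ (a + b) a≤i) (≤-reflexive (m+n∸m≡n a b))

reverseBlock : (ℕ → ℕ) → ℕ → ℕ → ℕ → ℕ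
reverseBlock g a b i = if does (i <? a) then g i else if does (i ≤? b) then a + b ∸ i else i

reverseBlock-< : ∀ g a b i → i < a → reverseBlock g a b i ≡ g i
reverseBlock-< g a b i i<a rewrite dec-true (i <? a) i<a = refl

reverseBlock-∈ : ∀ g a b i → a ≤ i → i ≤ b → reverseBlock g a b i ≡ a + b ∸ i
reverseBlock-∈ g a b i a≤i i≤b rewrite dec-false (i <? a) (≤⇒≯ a≤i) | dec-true (i ≤? b) i≤b = refl

reverseBlock-> : ∀ g a b i → a ≤ suc b → b < i → reverseBlock g a b i ≡ i
reverseBlock-> g a b i a≤1+b b<i
  rewrite dec-false (i <? a) (≤⇒≯ (≤-trans a≤1+b b<i)) | dec-false (i ≤? b) (<⇒≱ b<i) = refl

reverseBlock-involution : ∀ {n g a b} → Involution a g → a ≤ suc b → b < n → Involution n (reverseBlock g a b)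
reverseBlock-involution {n} {g} {a} {b} inv a≤1+b b<n i i<n with i <? a
... | yes i<a = subst (_< n) (sym (reverseBlock-< g a b i i<a)) (<-≤-trans (proj₁ (inv i i<a)) (≤-trans a≤1+b b<n))
              , trans (cong (reverseBlock g a b) (reverseBlock-< g a b i i<a))
                  (trans (reverseBlock-< g a b (g i) (proj₁ (inv i i<a))) (proj₂ (inv i i<a)))
... | no i≮a with i ≤? b
...   | yes i≤b = subst (_< n) (sym (reverseBlock-∈ g a b i a≤i i≤b)) (≤-<-trans (mirror-≤ a b i a≤i) b<n)
                , trans (cong (reverseBlock g a b) (reverseBlock-∈ g a b i a≤i i≤b))
                    (trans (reverseBlock-∈ g a b (a + b ∸ i) (mirror-≥ a b i i≤b) (mirror-≤ a b i a≤i))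
                      (m∸[m∸n]≡n (≤-trans i≤b (m≤n+m b a))))
  where a≤i = ≮⇒≥ i≮a
...   | no i≰b = subst (_< n) (sym (reverseBlock-> g a b i a≤1+b (≰⇒> i≰b))) i<n
               , trans (cong (reverseBlock g a b) (reverseBlock-> g a b i a≤1+b (≰⇒> i≰b)))
                   (reverseBlock-> g a b i a≤1+b (≰⇒> i≰b))

reverseBlock-cong : ∀ g h a b i → (∀ j → j < a → g j ≡ h j) → reverseBlock g a b i ≡ reverseBlock h a b i
reverseBlock-cong g h a b i g≡h with i <? a
... | yes i<a rewrite reverseBlock-< g a b i i<a | reverseBlock-< h a b i i<a = g≡h i i<a
... | no  i≮a rewrite dec-false (i <? a) i≮a = refl

reverseBlock-idem : ∀ g a b b' i → reverseBlock (reverseBlock g a b) a b' i ≡ reverseBlock g a b' i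
reverseBlock-idem g a b b' i with i <? a
... | yes i<a rewrite reverseBlock-< (reverseBlock g a b) a b' i i<a | reverseBlock-< g a b' i i<a
  = reverseBlock-< g a b i i<a
... | no  i≮a rewrite dec-false (i <? a) i≮a = refl

code-reverseBlock-< : ∀ g a b i → i < a → code (reverseBlock g a b) i ≡ code g i
code-reverseBlock-< g a b i i<a = code-cong _ _ i (λ j j≤i → reverseBlock-< g a b j (≤-<-trans j≤i i<a))

code-reverseBlock-∈ : ∀ g a b i → Involution a g → a ≤ i → i ≤ b → code (reverseBlock g a b) i ≡ i ∸ a
code-reverseBlock-∈ g a b i inv a≤i i≤b = begin
  count P i                                   ≡⟨ cong (count P) a+[i∸a]≡i ⟨
  count P (a + (i ∸ a))                       ≡⟨ count-+ P a (i ∸ a) ⟩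
  count P a + count (λ j → P (a + j)) (i ∸ a) ≡⟨ cong₂ _+_ (count-none P a belowBlock) (count-all _ (i ∸ a) inBlock) ⟩
  i ∸ a                                       ∎
  where
  open ≡-Reasoning
  h = reverseBlock g a b
  hi≡ = reverseBlock-∈ g a b i a≤i i≤b
  P : ℕ → Bool
  P j = does (h i <? h j)
  a+[i∸a]≡i = m+[n∸m]≡n a≤i
  belowBlock : ∀ j → j < a → P j ≡ false
  belowBlock j j<a rewrite hi≡ | reverseBlock-< g a b j j<a = dec-false (a + b ∸ i <? g j)
    (λ hi<gj → <-irrefl refl (<-≤-trans (<-trans hi<gj (proj₁ (inv j j<a))) (mirror-≥ a b i i≤b)))
  a+j<i : ∀ j → j < i ∸ a → a + j < i
  a+j<i j j<i∸a = subst (a + j <_) a+[i∸a]≡i (+-monoʳ-< a j<i∸a)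
  inBlock : ∀ j → j < i ∸ a → P (a + j) ≡ true
  inBlock j j<i∸a
    rewrite hi≡ | reverseBlock-∈ g a b (a + j) (m≤m+n a j) (<⇒≤ (<-≤-trans (a+j<i j j<i∸a) i≤b)) =
    dec-true (a + b ∸ i <? a + b ∸ (a + j)) (∸-monoʳ-< (a+j<i j j<i∸a) (≤-trans i≤b (m≤n+m b a)))

code-reverseBlock-> : ∀ g a b i → Involution a g → a ≤ suc b → b < i → code (reverseBlock g a b) i ≡ 0
code-reverseBlock-> g a b i inv a≤1+b b<i = count-none _ i λ j j<i →
  dec-false (h i <? h j) (λ hi<hj → <-irrefl refl (<-≤-trans (subst (_< h j) hi≡i hi<hj) (hj≤i j j<i)))
  where
  h = reverseBlock g a b
  hi≡i = reverseBlock-> g a b i a≤1+b b<i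
  hj≤i : ∀ j → j < i → h j ≤ i
  hj≤i j j<i with j <? a
  ... | yes j<a rewrite reverseBlock-< g a b j j<a = ≤-trans (<⇒≤ (proj₁ (inv j j<a))) (≤-trans a≤1+b b<i)
  ... | no j≮a with j ≤? b
  ...   | yes j≤b rewrite reverseBlock-∈ g a b j (≮⇒≥ j≮a) j≤b = ≤-trans (mirror-≤ a b j (≮⇒≥ j≮a)) (<⇒≤ b<i)
  ...   | no j≰b  rewrite reverseBlock-> g a b j a≤1+b (≰⇒> j≰b) = <⇒≤ j<i

-- The sign-reversing toggle

NoLargeAscent : ℕ → (ℕ → ℕ) → Set
NoLargeAscent n c = ∀ j → suc j < n → c (suc j) ≤ c j ⊎ c (suc j) ≡ suc (c j)

NoLargeAscent⇒≤suc : ∀ {n c} → NoLargeAscent n c → ∀ j → suc j < n → c (suc j) ≤ suc (c j)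
NoLargeAscent⇒≤suc noLarge j 1+j<n with noLarge j 1+j<n
... | inj₁ ≤cj   = m≤n⇒m≤1+n ≤cj
... | inj₂ ≡1+cj = ≤-reflexive ≡1+cj

NoLargeAscent-≤ : ∀ {m n c} → m ≤ n → NoLargeAscent n c → NoLargeAscent m c
NoLargeAscent-≤ m≤n noLarge j 1+j<m = noLarge j (<-≤-trans 1+j<m m≤n)

region : ∀ a b i → i < a ⊎ (a ≤ i × i ≤ b) ⊎ b < i
region a b i with i <? a
... | yes i<a = inj₁ i<a
... | no  i≮a with i ≤? b
...   | yes i≤b = inj₂ (inj₁ (≮⇒≥ i≮a , i≤b))
...   | no  i≰b = inj₂ (inj₂ (≰⇒> i≰b))

blockForm : ∀ {n b f} → Involution n f → FixesAbove b n f → b < n →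
  (∀ j → j < b → code f (suc j) ≤ suc (code f j)) →
  Involution (b ∸ code f b) f × (∀ i → i < n → f i ≡ reverseBlock f (b ∸ code f b) b i)
blockForm {n} {b} {f} inv fixed b<n slow = belowInvolution , f≡
  where
  a = b ∸ code f b
  a≤b = m∸n≤m b (code f b)
  reversed : ∀ i → a ≤ i → i ≤ b → f i ≡ a + b ∸ i
  reversed = reverses-block (b ∸ a) (sym (m+[n∸m]≡n a≤b)) inv fixed b<n (code-on-block inv fixed b<n slow)
  belowInvolution : Involution a f
  belowInvolution i i<a with f i <? a | f i ≤? b
  ... | yes fi<a | _ = fi<a , proj₂ (inv i i<n)
    where i<n = <-trans (<-≤-trans i<a a≤b) b<n
  ... | no fi≮a | yes fi≤b = ⊥-elim (<-irrefl refl (<-≤-trans i<a (subst (a ≤_)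
        (trans (sym (reversed (f i) (≮⇒≥ fi≮a) fi≤b)) (proj₂ (inv i i<n))) (mirror-≥ a b (f i) fi≤b))))
    where i<n = <-trans (<-≤-trans i<a a≤b) b<n
  ... | no fi≮a | no fi≰b = ⊥-elim (fi≮a (subst (_< a) (sym fi≡i) i<a))
    where
    i<n = <-trans (<-≤-trans i<a a≤b) b<n
    fi≡i = trans (sym (fixed (f i) (≰⇒> fi≰b) (proj₁ (inv i i<n)))) (proj₂ (inv i i<n))
  f≡ : ∀ i → i < n → f i ≡ reverseBlock f a b i
  f≡ i i<n with region a b i
  ... | inj₁ i<a              = sym (reverseBlock-< f a b i i<a)
  ... | inj₂ (inj₁ (a≤i , i≤b)) = trans (reversed i a≤i i≤b) (sym (reverseBlock-∈ f a b i a≤i i≤b))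
  ... | inj₂ (inj₂ b<i)       = trans (fixed i b<i i<n) (sym (reverseBlock-> f a b i (m≤n⇒m≤1+n a≤b) b<i))

reverseBlock-noLargeAscent : ∀ n {g a b} → Involution a g → a ≤ suc b →
  NoLargeAscent a (code g) → NoLargeAscent n (code (reverseBlock g a b))
reverseBlock-noLargeAscent n {g} {a} {b} inv a≤1+b noLarge j _ with region a b (suc j)
... | inj₁ 1+j<a rewrite code-reverseBlock-< g a b (suc j) 1+j<a | code-reverseBlock-< g a b j (<-trans (n<1+n j) 1+j<a)
  = noLarge j 1+j<a
... | inj₂ (inj₂ b<1+j) = inj₁ (subst (_≤ code (reverseBlock g a b) j) (sym (code-reverseBlock-> g a b (suc j) inv a≤1+b b<1+j)) z≤n)
... | inj₂ (inj₁ (a≤1+j , 1+j≤b)) with a ≤? j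
...   | no  a≰j with refl ← ≤-antisym a≤1+j (≰⇒> a≰j) =
  inj₁ (subst (_≤ code (reverseBlock g a b) j)
    (sym (trans (code-reverseBlock-∈ g a b a inv ≤-refl 1+j≤b) (n∸n≡0 a))) z≤n)
...   | yes a≤j = inj₂ (begin
  code (reverseBlock g a b) (suc j) ≡⟨ code-reverseBlock-∈ g a b (suc j) inv a≤1+j 1+j≤b ⟩
  suc j ∸ a                         ≡⟨ +-∸-assoc 1 a≤j ⟩
  suc (j ∸ a)                       ≡⟨ cong suc (code-reverseBlock-∈ g a b j inv a≤j (<⇒≤ 1+j≤b)) ⟨
  suc (code (reverseBlock g a b) j) ∎)
  where open ≡-Reasoning

isNonzero : ℕ → Bool
isNonzero zero    = false
isNonzero (suc _) = true

-- Only the code at b + 1 changes, from 0 to b + 1 - a.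
nonzeros-reverseBlock-suc : ∀ n {g a b} → Involution a g → a ≤ b → suc b < n →
  count (isNonzero ∘ code (reverseBlock g a (suc b))) n ≡ suc (count (isNonzero ∘ code (reverseBlock g a b)) n)
nonzeros-reverseBlock-suc n {g} {a} {b} inv a≤b 1+b<n = begin
  count Q n                     ≡⟨ +-identityʳ _ ⟨
  count Q n + 0                 ≡⟨ cong (λ x → count Q n + indicator x) Pb ⟨
  count Q n + indicator (P p)   ≡⟨ count-update P Q n p 1+b<n agree ⟨
  count P n + indicator (Q p)   ≡⟨ cong (λ x → count P n + indicator x) Qb ⟩
  count P n + 1                 ≡⟨ +-comm _ 1 ⟩
  suc (count P n)               ∎
  where
  open ≡-Reasoning
  p = suc b
  P Q : ℕ → Bool
  P = isNonzero ∘ code (reverseBlock g a b)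
  Q = isNonzero ∘ code (reverseBlock g a (suc b))
  Pb : P p ≡ false
  Pb rewrite code-reverseBlock-> g a b p inv (m≤n⇒m≤1+n a≤b) ≤-refl = refl
  Qb : Q p ≡ true
  Qb rewrite code-reverseBlock-∈ g a (suc b) p inv (m≤n⇒m≤1+n a≤b) ≤-refl | +-∸-assoc 1 a≤b = refl
  agree : ∀ j → j < n → j ≢ p → P j ≡ Q j
  agree j _ j≢p with region a b j
  ... | inj₁ j<a rewrite code-reverseBlock-< g a b j j<a | code-reverseBlock-< g a (suc b) j j<a = refl
  ... | inj₂ (inj₁ (a≤j , j≤b))
    rewrite code-reverseBlock-∈ g a b j inv a≤j j≤b | code-reverseBlock-∈ g a (suc b) j inv a≤j (m≤n⇒m≤1+n j≤b)
    = refl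
  ... | inj₂ (inj₂ b<j)
    rewrite code-reverseBlock-> g a b j inv (m≤n⇒m≤1+n a≤b) b<j
          | code-reverseBlock-> g a (suc b) j inv (m≤n⇒m≤1+n (m≤n⇒m≤1+n a≤b)) (≤∧≢⇒< b<j (j≢p ∘ sym))
    = refl

isNonzero-≢0 : ∀ {x} → x ≢ 0 → isNonzero x ≡ true
isNonzero-≢0 {zero}  x≢0 = ⊥-elim (x≢0 refl)
isNonzero-≢0 {suc x} _   = refl

record Admissible (n : ℕ) (u f : ℕ → ℕ) : Set where
  field
    involution    : Involution n f
    dominated     : ∀ i → i < n → code f i ≤ code u i
    noLargeAscent : NoLargeAscent n (code f)

-- The sign-reversing involution on the admissible f below u, where k = K + 1 is the last
-- position at which u has a nonzero code: such an f ends with a reversed block [a, b],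
-- b ∈ {K, k}, and toggling moves b between K and k (switching whether code f k is zero).
module Toggle {n K u} (invu : Involution n u) (k<n : suc K < n) (0<codeu : 0 < code u (suc K))
              (codeu≡0 : ∀ j → suc K < j → j < n → code u j ≡ 0) where

  k : ℕ
  k = suc K

  K<n : K < n
  K<n = <-trans (n<1+n K) k<n

  grow shrink toggle : (ℕ → ℕ) → ℕ → ℕ
  grow   f = reverseBlock f (K ∸ code f K) k
  shrink f = reverseBlock f (k ∸ code f k) K
  toggle f = if isNonzero (code f k) then shrink f else grow f

  module _ {f} (adm : Admissible n u f) where
    open Admissible adm

    code≡0-above : ∀ j → k < j → j < n → code f j ≡ 0
    code≡0-above j k<j j<n = n≤0⇒n≡0 (≤-trans (dominated j j<n) (≤-reflexive (codeu≡0 j k<j j<n)))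

    slow : ∀ {b} → b < n → ∀ j → j < b → code f (suc j) ≤ suc (code f j)
    slow b<n j j<b = NoLargeAscent⇒≤suc noLargeAscent j (≤-<-trans j<b b<n)

    module Grow (code≡0 : code f k ≡ 0) where

      fixed : FixesAbove K n f
      fixed = codes≡0⇒FixesAbove involution λ j K<j j<n → case m≤n⇒m<n∨m≡n K<j of λ where
        (inj₁ k<j)  → code≡0-above j k<j j<n
        (inj₂ refl) → code≡0

      a : ℕ
      a = K ∸ code f K

      a≤K : a ≤ K
      a≤K = m∸n≤m K (code f K)

      a<k : a < k
      a<k = s≤s a≤K

      form : Involution a f × (∀ i → i < n → f i ≡ reverseBlock f a K i)
      form = blockForm involution fixed K<n (slow K<n)

      invBelow : Involution a f
      invBelow = proj₁ form

      code≡ : ∀ i → i < n → code f i ≡ code (reverseBlock f a K) i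
      code≡ i i<n = code-cong _ _ i (λ j j≤i → proj₂ form j (≤-<-trans j≤i i<n))

      code-block : ∀ i → a ≤ i → i ≤ K → code f i ≡ i ∸ a
      code-block i a≤i i≤K = trans (code≡ i (<-trans (s≤s i≤K) k<n)) (code-reverseBlock-∈ f a K i invBelow a≤i i≤K)

      code-grown : code (grow f) k ≡ k ∸ a
      code-grown = code-reverseBlock-∈ f a k k invBelow (<⇒≤ a<k) ≤-refl

      admissible : Admissible n u (grow f)
      admissible = record
        { involution    = reverseBlock-involution invBelow (m≤n⇒m≤1+n (<⇒≤ a<k)) k<n
        ; dominated     = dom
        ; noLargeAscent = reverseBlock-noLargeAscent n invBelow (m≤n⇒m≤1+n (<⇒≤ a<k))
                            (NoLargeAscent-≤ (<⇒≤ (<-trans a<k k<n)) noLargeAscent)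
        }
        where
        dom : ∀ i → i < n → code (grow f) i ≤ code u i
        dom i i<n with region a K i
        ... | inj₁ i<a = subst (_≤ code u i) (sym (code-reverseBlock-< f a k i i<a)) (dominated i i<n)
        ... | inj₂ (inj₁ (a≤i , i≤K)) = subst (_≤ code u i)
              (trans (code-block i a≤i i≤K) (sym (code-reverseBlock-∈ f a k i invBelow a≤i (m≤n⇒m≤1+n i≤K))))
              (dominated i i<n)
        ... | inj₂ (inj₂ K<i) with m≤n⇒m<n∨m≡n K<i
        ...   | inj₁ k<i  = subst (_≤ code u i) (sym (code-reverseBlock-> f a k i invBelow (m≤n⇒m≤1+n (<⇒≤ a<k)) k<i)) z≤n
        ...   | inj₂ refl = subst (_≤ code u k) (sym code-grown)
              (block-code≤ invu codeu≡0 k<n 0<codeu (code f) a a<k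
                 (λ i a≤i i<k → code-block i a≤i (≤-pred i<k)) dominated)

      nonzeros-grow : count (isNonzero ∘ code (grow f)) n ≡ suc (count (isNonzero ∘ code f) n)
      nonzeros-grow = trans (nonzeros-reverseBlock-suc n invBelow a≤K k<n)
        (cong suc (count-cong n (λ i i<n → cong isNonzero (sym (code≡ i i<n)))))

      code≢0 : ∀ g → (∀ i → i < n → g i ≡ grow f i) → code g k ≢ 0
      code≢0 g g≡ = m>n⇒m∸n≢0 a<k ∘ trans (sym (trans (code-cong g (grow f) k (λ j j≤k → g≡ j (≤-<-trans j≤k k<n)))
                                                    code-grown))

      shrink-grow : ∀ g → (∀ i → i < n → g i ≡ grow f i) → ∀ i → i < n → shrink g i ≡ f i
      shrink-grow g g≡ i i<n = begin
        reverseBlock g (k ∸ code g k) K i          ≡⟨ cong (λ x → reverseBlock g (k ∸ x) K i) codeg ⟩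
        reverseBlock g (k ∸ (k ∸ a)) K i           ≡⟨ cong (λ x → reverseBlock g x K i) (m∸[m∸n]≡n (<⇒≤ a<k)) ⟩
        reverseBlock g a K i                       ≡⟨ reverseBlock-cong g (grow f) a K i (λ j j<a → g≡ j (<-trans j<a (<-trans a<k k<n))) ⟩
        reverseBlock (grow f) a K i                ≡⟨ reverseBlock-idem f a k K i ⟩
        reverseBlock f a K i                       ≡⟨ proj₂ form i i<n ⟨
        f i                                        ∎
        where
        open ≡-Reasoning
        codeg : code g k ≡ k ∸ a
        codeg = trans (code-cong g (grow f) k (λ j j≤k → g≡ j (≤-<-trans j≤k k<n))) code-grown

    module Shrink (code≢0 : code f k ≢ 0) where

      fixed : FixesAbove k n f
      fixed = codes≡0⇒FixesAbove involution code≡0-above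

      a : ℕ
      a = k ∸ code f k

      a<k : a < k
      a<k = ∸-monoʳ-< {k} {code f k} {0} (n≢0⇒n>0 code≢0) (count≤n (λ j → does (f k <? f j)) k)

      a≤K : a ≤ K
      a≤K = ≤-pred a<k

      form : Involution a f × (∀ i → i < n → f i ≡ reverseBlock f a k i)
      form = blockForm involution fixed k<n (slow k<n)

      invBelow : Involution a f
      invBelow = proj₁ form

      code≡ : ∀ i → i < n → code f i ≡ code (reverseBlock f a k) i
      code≡ i i<n = code-cong _ _ i (λ j j≤i → proj₂ form j (≤-<-trans j≤i i<n))

      code-shrunk : code (shrink f) k ≡ 0
      code-shrunk = code-reverseBlock-> f a K k invBelow (m≤n⇒m≤1+n a≤K) ≤-refl

      admissible : Admissible n u (shrink f)
      admissible = record
        { involution    = reverseBlock-involution invBelow (m≤n⇒m≤1+n a≤K) K<n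
        ; dominated     = λ i i<n → ≤-trans (shrinks i i<n) (dominated i i<n)
        ; noLargeAscent = reverseBlock-noLargeAscent n invBelow (m≤n⇒m≤1+n a≤K)
                            (NoLargeAscent-≤ (<⇒≤ (<-trans a<k k<n)) noLargeAscent)
        }
        where
        shrinks : ∀ i → i < n → code (shrink f) i ≤ code f i
        shrinks i i<n with region a K i
        ... | inj₁ i<a = ≤-reflexive (code-reverseBlock-< f a K i i<a)
        ... | inj₂ (inj₁ (a≤i , i≤K)) = ≤-reflexive (trans (code-reverseBlock-∈ f a K i invBelow a≤i i≤K)
              (sym (trans (code≡ i i<n) (code-reverseBlock-∈ f a k i invBelow a≤i (m≤n⇒m≤1+n i≤K)))))
        ... | inj₂ (inj₂ K<i) = subst (_≤ code f i) (sym (code-reverseBlock-> f a K i invBelow (m≤n⇒m≤1+n a≤K) K<i)) z≤n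

      nonzeros-shrink : count (isNonzero ∘ code f) n ≡ suc (count (isNonzero ∘ code (shrink f)) n)
      nonzeros-shrink = trans (count-cong n (λ i i<n → cong isNonzero (code≡ i i<n)))
        (nonzeros-reverseBlock-suc n invBelow a≤K k<n)

      code≡0 : ∀ g → (∀ i → i < n → g i ≡ shrink f i) → code g k ≡ 0
      code≡0 g g≡ = trans (code-cong g (shrink f) k (λ j j≤k → g≡ j (≤-<-trans j≤k k<n))) code-shrunk

      grow-shrink : ∀ g → (∀ i → i < n → g i ≡ shrink f i) → ∀ i → i < n → grow g i ≡ f i
      grow-shrink g g≡ i i<n = begin
        reverseBlock g (K ∸ code g K) k i          ≡⟨ cong (λ x → reverseBlock g (K ∸ x) k i) codeg ⟩
        reverseBlock g (K ∸ (K ∸ a)) k i           ≡⟨ cong (λ x → reverseBlock g x k i) (m∸[m∸n]≡n a≤K) ⟩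
        reverseBlock g a k i                       ≡⟨ reverseBlock-cong g (shrink f) a k i (λ j j<a → g≡ j (<-trans j<a (<-trans a<k k<n))) ⟩
        reverseBlock (shrink f) a k i              ≡⟨ reverseBlock-idem f a K k i ⟩
        reverseBlock f a k i                       ≡⟨ proj₂ form i i<n ⟨
        f i                                        ∎
        where
        open ≡-Reasoning
        codeg : code g K ≡ K ∸ a
        codeg = trans (code-cong g (shrink f) K (λ j j≤K → g≡ j (≤-<-trans j≤K K<n)))
                      (code-reverseBlock-∈ f a K K invBelow a≤K ≤-refl)

  nonzeroCount : (ℕ → ℕ) → ℕ
  nonzeroCount f = count (isNonzero ∘ code f) n

  toggle≡grow : ∀ {f} → code f k ≡ 0 → toggle f ≡ grow f
  toggle≡grow {f} code≡0 = cong (λ c → if isNonzero c then shrink f else grow f) code≡0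

  toggle≡shrink : ∀ {f} → code f k ≢ 0 → toggle f ≡ shrink f
  toggle≡shrink {f} code≢0 = cong (λ b → if b then shrink f else grow f) (isNonzero-≢0 code≢0)

  -1^suc : ∀ m → -1ℤ ^ suc m ≡ - (-1ℤ ^ m)
  -1^suc m = ℤ.-1*i≡-i (-1ℤ ^ m)

  toggle-admissible : ∀ {f} → Admissible n u f → Admissible n u (toggle f)
  toggle-admissible {f} adm with code f k ≟ 0
  ... | yes code≡0 = subst (Admissible n u) (sym (toggle≡grow {f} code≡0)) (Grow.admissible adm code≡0)
  ... | no  code≢0 = subst (Admissible n u) (sym (toggle≡shrink {f} code≢0)) (Shrink.admissible adm code≢0)

  toggle-sign : ∀ {f} → Admissible n u f → -1ℤ ^ nonzeroCount (toggle f) ≡ - (-1ℤ ^ nonzeroCount f)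
  toggle-sign {f} adm with code f k ≟ 0
  ... | yes code≡0 = begin
    -1ℤ ^ nonzeroCount (toggle f)            ≡⟨ cong (λ h → -1ℤ ^ nonzeroCount h) (toggle≡grow {f} code≡0) ⟩
    -1ℤ ^ nonzeroCount (grow f)              ≡⟨ cong (-1ℤ ^_) (Grow.nonzeros-grow adm code≡0) ⟩
    -1ℤ ^ suc (nonzeroCount f)               ≡⟨ -1^suc (nonzeroCount f) ⟩
    - (-1ℤ ^ nonzeroCount f)                 ∎
    where open ≡-Reasoning
  ... | no  code≢0 = begin
    -1ℤ ^ nonzeroCount (toggle f)            ≡⟨ cong (λ h → -1ℤ ^ nonzeroCount h) (toggle≡shrink {f} code≢0) ⟩
    -1ℤ ^ nonzeroCount (shrink f)            ≡⟨ ℤ.neg-involutive _ ⟨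
    - - (-1ℤ ^ nonzeroCount (shrink f))      ≡⟨ cong -_ (-1^suc (nonzeroCount (shrink f))) ⟨
    - (-1ℤ ^ suc (nonzeroCount (shrink f)))  ≡⟨ cong (λ m → - (-1ℤ ^ m)) (Shrink.nonzeros-shrink adm code≢0) ⟨
    - (-1ℤ ^ nonzeroCount f)                 ∎
    where open ≡-Reasoning

  toggle-involutive : ∀ {f} → Admissible n u f → ∀ g → (∀ i → i < n → g i ≡ toggle f i) →
                      ∀ i → i < n → toggle g i ≡ f i
  toggle-involutive {f} adm g g≡ with code f k ≟ 0
  ... | yes code≡0 = λ i i<n →
    trans (cong (λ h → h i) (toggle≡shrink {g} (Grow.code≢0 adm code≡0 g g≡grow))) (Grow.shrink-grow adm code≡0 g g≡grow i i<n)
    where g≡grow = λ i i<n → trans (g≡ i i<n) (cong (λ h → h i) (toggle≡grow {f} code≡0))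
  ... | no  code≢0 = λ i i<n →
    trans (cong (λ h → h i) (toggle≡grow {g} (Shrink.code≡0 adm code≢0 g g≡shrink))) (Shrink.grow-shrink adm code≢0 g g≡shrink i i<n)
    where g≡shrink = λ i i<n → trans (g≡ i i<n) (cong (λ h → h i) (toggle≡shrink {f} code≢0))

-- Signed sums and the Möbius function

sumℤ-↭ : ∀ {xs ys} → xs ↭ ys → sumℤ xs ≡ sumℤ ys
sumℤ-↭ p = foldr-commMonoid (setoid ℤ) ℤ.+-0-isCommutativeMonoid (↭⇒↭ₛ p)

sumℤ-neg : ∀ {A : Set} (G : A → ℤ) xs → sumℤ (map (-_ ∘ G) xs) ≡ - sumℤ (map G xs)
sumℤ-neg G []       = refl
sumℤ-neg G (x ∷ xs) = trans (cong (- G x +ℤ_) (sumℤ-neg G xs)) (sym (ℤ.neg-distrib-+ (G x) _))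

≡-self⇒0 : ∀ (x : ℤ) → x ≡ - x → x ≡ 0ℤ
≡-self⇒0 ℤ.+0         _ = refl
≡-self⇒0 ℤ.+[1+ _ ]  ()
≡-self⇒0 ℤ.-[1+ _ ]  ()

map-involution-↭ : ∀ {A : Set} (τ : A → A) {xs} → Unique xs → (∀ x → τ (τ x) ≡ x) →
                   (∀ {x} → x ∈ xs → τ x ∈ xs) → map τ xs ↭ xs
map-involution-↭ τ {xs} unique τ-involutive τ-closed =
  ∼bag⇒↭ (unique∧set⇒bag (Unique.map⁺ τ-injective unique) unique (mk⇔ to from))
  where
  τ-injective : ∀ {x y} → τ x ≡ τ y → x ≡ y
  τ-injective {x} {y} τx≡τy = trans (sym (τ-involutive x)) (trans (cong τ τx≡τy) (τ-involutive y))
  to : ∀ {z} → z ∈ map τ xs → z ∈ xs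
  to z∈ with _ , x∈ , refl ← ∈-map⁻ τ z∈ = τ-closed x∈
  from : ∀ {z} → z ∈ xs → z ∈ map τ xs
  from {z} z∈ = subst (_∈ map τ xs) (τ-involutive z) (∈-map⁺ τ (τ-closed z∈))

sumℤ-signReversing≡0 : ∀ {A : Set} (τ : A → A) (G : A → ℤ) {xs} → Unique xs → (∀ x → τ (τ x) ≡ x) →
  (∀ {x} → x ∈ xs → τ x ∈ xs) → (∀ {x} → x ∈ xs → G (τ x) ≡ - G x) → sumℤ (map G xs) ≡ 0ℤ
sumℤ-signReversing≡0 τ G {xs} unique τ-involutive τ-closed reverses = ≡-self⇒0 _ (begin
  sumℤ (map G xs)            ≡⟨ sumℤ-↭ (↭.map⁺ G (map-involution-↭ τ unique τ-involutive τ-closed)) ⟨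
  sumℤ (map G (map τ xs))    ≡⟨ cong sumℤ (map-∘ xs) ⟨
  sumℤ (map (G ∘ τ) xs)      ≡⟨ cong sumℤ (map-cong-local (All.tabulate reverses)) ⟩
  sumℤ (map (-_ ∘ G) xs)     ≡⟨ sumℤ-neg G xs ⟩
  - sumℤ (map G xs)          ∎)
  where open ≡-Reasoning

module _ {A : Set} {P Q : A → Set} (P? : ∀ x → Dec (P x)) (Q? : ∀ x → Dec (Q x)) where

  filter-congᴸ : ∀ xs → (∀ {x} → x ∈ xs → P x → Q x) → (∀ {x} → x ∈ xs → Q x → P x) →
                 filter P? xs ≡ filter Q? xs
  filter-congᴸ []       _   _   = refl
  filter-congᴸ (x ∷ xs) P⇒Q Q⇒P with P? x | Q? x
  ... | yes _  | yes _  = cong (x ∷_) (filter-congᴸ xs (P⇒Q ∘ there) (Q⇒P ∘ there))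
  ... | no  _  | no  _  = filter-congᴸ xs (P⇒Q ∘ there) (Q⇒P ∘ there)
  ... | yes Px | no ¬Qx = ⊥-elim (¬Qx (P⇒Q (here refl) Px))
  ... | no ¬Px | yes Qx = ⊥-elim (¬Px (Q⇒P (here refl) Qx))

  length-filter-mono : ∀ xs → (∀ {x} → x ∈ xs → P x → Q x) → length (filter P? xs) ≤ length (filter Q? xs)
  length-filter-mono []       _   = z≤n
  length-filter-mono (x ∷ xs) P⇒Q with P? x | Q? x
  ... | yes _  | yes _  = s≤s (length-filter-mono xs (P⇒Q ∘ there))
  ... | no  _  | yes _  = m≤n⇒m≤1+n (length-filter-mono xs (P⇒Q ∘ there))
  ... | no  _  | no  _  = length-filter-mono xs (P⇒Q ∘ there)
  ... | yes Px | no ¬Qx = ⊥-elim (¬Qx (P⇒Q (here refl) Px))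

  length-filter-mono-< : ∀ xs → (∀ {x} → x ∈ xs → P x → Q x) → ∀ {t} → t ∈ xs → ¬ P t → Q t →
                         length (filter P? xs) < length (filter Q? xs)
  length-filter-mono-< (x ∷ xs) P⇒Q (here refl) ¬Pt Qt with P? x | Q? x
  ... | yes Pt | _     = ⊥-elim (¬Pt Pt)
  ... | no  _  | no ¬Q = ⊥-elim (¬Q Qt)
  ... | no  _  | yes _ = s≤s (length-filter-mono xs (P⇒Q ∘ there))
  length-filter-mono-< (x ∷ xs) P⇒Q (there t∈) ¬Pt Qt with P? x | Q? x
  ... | yes _  | yes _  = s≤s (length-filter-mono-< xs (P⇒Q ∘ there) t∈ ¬Pt Qt)
  ... | no  _  | yes _  = m≤n⇒m≤1+n (length-filter-mono-< xs (P⇒Q ∘ there) t∈ ¬Pt Qt)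
  ... | no  _  | no  _  = length-filter-mono-< xs (P⇒Q ∘ there) t∈ ¬Pt Qt
  ... | yes Px | no ¬Qx = ⊥-elim (¬Qx (P⇒Q (here refl) Px))

  -- The sum over a closed interval is the sum over the half-open one plus the endpoint.
  sumℤ-filter-insert : ∀ (G : A → ℤ) {xs u} → Unique xs → u ∈ xs → P u → ¬ Q u →
    (∀ {x} → x ∈ xs → x ≢ u → P x → Q x) → (∀ {x} → x ∈ xs → x ≢ u → Q x → P x) →
    sumℤ (map G (filter P? xs)) ≡ G u +ℤ sumℤ (map G (filter Q? xs))
  sumℤ-filter-insert G {x ∷ xs} (x∉ ∷ unique) (here refl) Pu ¬Qu P⇒Q Q⇒P with P? x | Q? x
  ... | no ¬Pu | _     = ⊥-elim (¬Pu Pu)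
  ... | yes _  | yes Qu = ⊥-elim (¬Qu Qu)
  ... | yes _  | no  _  = cong (λ ys → G x +ℤ sumℤ (map G ys)) (filter-congᴸ xs
        (λ y∈ → P⇒Q (there y∈) (All.lookup x∉ y∈ ∘ sym)) (λ y∈ → Q⇒P (there y∈) (All.lookup x∉ y∈ ∘ sym)))
  sumℤ-filter-insert G {x ∷ xs} {u} (x∉ ∷ unique) (there u∈) Pu ¬Qu P⇒Q Q⇒P with P? x | Q? x
  ... | yes _  | yes _  = begin
    G x +ℤ sumℤ (map G (filter P? xs))                  ≡⟨ cong (G x +ℤ_) ih ⟩
    G x +ℤ (G u +ℤ sumℤ (map G (filter Q? xs)))        ≡⟨ ℤ.+-assoc (G x) _ _ ⟨
    G x +ℤ G u +ℤ sumℤ (map G (filter Q? xs))          ≡⟨ cong (_+ℤ _) (ℤ.+-comm (G x) (G u)) ⟩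
    G u +ℤ G x +ℤ sumℤ (map G (filter Q? xs))          ≡⟨ ℤ.+-assoc (G u) _ _ ⟩
    G u +ℤ (G x +ℤ sumℤ (map G (filter Q? xs)))        ∎
    where
    open ≡-Reasoning
    ih = sumℤ-filter-insert G unique u∈ Pu ¬Qu (P⇒Q ∘ there) (Q⇒P ∘ there)
  ... | no  _  | no  _  = sumℤ-filter-insert G unique u∈ Pu ¬Qu (P⇒Q ∘ there) (Q⇒P ∘ there)
  ... | yes Px | no ¬Qx = ⊥-elim (¬Qx (P⇒Q (here refl) (All.lookup x∉ u∈) Px))
  ... | no ¬Px | yes Qx = ⊥-elim (¬Px (Q⇒P (here refl) (All.lookup x∉ u∈) Qx))

module MobiusCharacterisation {A : Set} (L : List A) (_≟A_ : DecidableEquality A)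
  (_⊑_ : A → A → Set) (_⊑?_ : ∀ x y → Dec (x ⊑ y)) (unique : Unique L)
  (⊑-refl : ∀ {x} → x ∈ L → x ⊑ x)
  (⊑-trans : ∀ {x y z} → x ∈ L → y ∈ L → z ∈ L → x ⊑ y → y ⊑ z → x ⊑ z)
  (⊑-antisym : ∀ {x y} → x ∈ L → y ∈ L → x ⊑ y → y ⊑ x → x ≡ y) where

  open FinitePoset L _≟A_ _⊑_ _⊑?_

  depth : A → ℕ
  depth u = length (filter (_⊏? u) L)

  depth-mono : ∀ {t u} → t ∈ L → u ∈ L → t ⊏ u → depth t < depth u
  depth-mono {t} {u} t∈ u∈ (t⊑u , t≢u) = length-filter-mono-< (_⊏? t) (_⊏? u) L
    (λ {x} x∈ (x⊑t , x≢t) → ⊑-trans x∈ t∈ u∈ x⊑t t⊑u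
                           , λ x≡u → t≢u (⊑-antisym t∈ u∈ t⊑u (subst (_⊑ t) x≡u x⊑t)))
    t∈ (λ (_ , t≢t) → t≢t refl) (t⊑u , t≢u)

  depth<length : ∀ {u} → u ∈ L → depth u < length L
  depth<length {u} u∈ = filter-notAll (_⊏? u) L (Any.map (λ { refl (_ , u≢u) → u≢u refl }) u∈)

  module _ (s : A) (G : A → ℤ) (G-s : G s ≡ 1ℤ)
    (G-sum : ∀ {u} → u ∈ L → s ⊑ u → s ≢ u → sumℤ (map G (filter (λ t → (s ⊑? t) ×-dec (t ⊑? u)) L)) ≡ 0ℤ)
    where

    mobiusFuel≡ : ∀ f {u} → u ∈ L → s ⊑ u → depth u < f → mobiusFuel f s u ≡ G u
    mobiusFuel≡ (suc f) {u} u∈ s⊑u d<1+f with s ≟A u | s ⊑? u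
    ... | yes refl | _      = sym G-s
    ... | no _     | no s⋢u = ⊥-elim (s⋢u s⊑u)
    ... | no s≢u   | yes _  = begin
      - sumℤ (map (mobiusFuel f s) halfOpen)  ≡⟨ cong (-_ ∘ sumℤ) (map-cong-local (All.tabulate ih)) ⟩
      - sumℤ (map G halfOpen)                 ≡⟨ inverseˡ-unique (G u) _ split ⟨
      G u                                     ∎
      where
      open ≡-Reasoning
      halfOpen = filter (λ t → (s ⊑? t) ×-dec (t ⊏? u)) L
      ih : ∀ {t} → t ∈ halfOpen → mobiusFuel f s t ≡ G t
      ih t∈ with t∈L , s⊑t , t⊏u ← ∈-filter⁻ (λ t → (s ⊑? t) ×-dec (t ⊏? u)) {xs = L} t∈ =
        mobiusFuel≡ f t∈L s⊑t (<-≤-trans (depth-mono t∈L u∈ t⊏u) (≤-pred d<1+f))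
      split : G u +ℤ sumℤ (map G halfOpen) ≡ 0ℤ
      split = trans (sym (sumℤ-filter-insert (λ t → (s ⊑? t) ×-dec (t ⊑? u)) (λ t → (s ⊑? t) ×-dec (t ⊏? u)) G
                unique u∈ (s⊑u , ⊑-refl u∈) (λ (_ , _ , u≢u) → u≢u refl)
                (λ _ x≢u (s⊑x , x⊑u) → s⊑x , x⊑u , x≢u) (λ _ _ (s⊑x , x⊑u , _) → s⊑x , x⊑u)))
              (G-sum u∈ s⊑u s≢u)

    mobius≡ : ∀ {u} → u ∈ L → s ⊑ u → mobius s u ≡ G u
    mobius≡ u∈ s⊑u = mobiusFuel≡ (length L) u∈ s⊑u (depth<length u∈)

atℕ : List ℕ → ℕ → ℕ
atℕ []       _       = 0
atℕ (x ∷ xs) zero    = x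
atℕ (x ∷ xs) (suc i) = atℕ xs i

-- junk value 0 beyond the length of the word
⟦_⟧ : ∀ {n} → Word n → ℕ → ℕ
⟦ w ⟧ = atℕ (map toℕ (toList w))

atℕ-lookup : ∀ {m k} (v : Vec (Fin m) k) i (i<k : i < k) → atℕ (map toℕ (toList v)) i ≡ toℕ (lookup v (fromℕ< i<k))
atℕ-lookup (x ∷ v) zero    _         = refl
atℕ-lookup (x ∷ v) (suc i) (s≤s i<k) = atℕ-lookup v i i<k

⟦⟧-toℕ : ∀ {n} (w : Word n) j → ⟦ w ⟧ (toℕ j) ≡ toℕ (lookup w j)
⟦⟧-toℕ w j = trans (atℕ-lookup w (toℕ j) (toℕ<n j)) (cong (toℕ ∘ lookup w) (fromℕ<-toℕ j (toℕ<n j)))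

⟦⟧<n : ∀ {n} (w : Word n) i → i < n → ⟦ w ⟧ i < n
⟦⟧<n w i i<n = subst (_< _) (sym (atℕ-lookup w i i<n)) (toℕ<n _)

⟦⟧-injective : ∀ {n} (v w : Word n) → (∀ i → i < n → ⟦ v ⟧ i ≡ ⟦ w ⟧ i) → v ≡ w
⟦⟧-injective v w v≡w = trans (sym (Vec.tabulate∘lookup v)) (trans (Vec.tabulate-cong (λ j → toℕ-injective
  (trans (sym (⟦⟧-toℕ v j)) (trans (v≡w (toℕ j) (toℕ<n j)) (⟦⟧-toℕ w j))))) (Vec.tabulate∘lookup w))

IsInvolution⇒Involution : ∀ {n} (w : Word n) → IsInvolution w → Involution n ⟦ w ⟧
IsInvolution⇒Involution w w-inv i i<n = ⟦⟧<n w i i<n , (begin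
  ⟦ w ⟧ (⟦ w ⟧ i)                        ≡⟨ cong ⟦ w ⟧ (atℕ-lookup w i i<n) ⟩
  ⟦ w ⟧ (toℕ (lookup w (fromℕ< i<n)))    ≡⟨ ⟦⟧-toℕ w (lookup w (fromℕ< i<n)) ⟩
  toℕ (lookup w (lookup w (fromℕ< i<n))) ≡⟨ cong toℕ (w-inv (fromℕ< i<n)) ⟩
  toℕ (fromℕ< i<n)                       ≡⟨ toℕ-fromℕ< i<n ⟩
  i                                      ∎)
  where open ≡-Reasoning

posIn-first : ∀ j (xs : List ℕ) p → p < length xs → atℕ xs p ≡ j → (∀ q → q < p → atℕ xs q ≢ j) → posIn j xs ≡ p
posIn-first j (x ∷ xs) p p<len xs[p]≡j earlier≢j with x ≟ j
posIn-first j (x ∷ xs) zero    _           _       _        | yes _   = refl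
posIn-first j (x ∷ xs) (suc p) _           _       earlier≢j | yes x≡j = ⊥-elim (earlier≢j 0 z<s x≡j)
posIn-first j (x ∷ xs) zero    _           x≡j     _        | no x≢j  = ⊥-elim (x≢j x≡j)
posIn-first j (x ∷ xs) (suc p) (s≤s p<len) xs[p]≡j earlier≢j | no _ =
  cong suc (posIn-first j xs p p<len xs[p]≡j (λ q q<p → earlier≢j (suc q) (s<s q<p)))

winv≡⟦⟧ : ∀ {n} (w : Word n) → IsInvolution w → ∀ j → j < n → winv w j ≡ ⟦ w ⟧ j
winv≡⟦⟧ {n} w w-inv j j<n = posIn-first j (map toℕ (toList w)) (⟦ w ⟧ j)
  (subst (⟦ w ⟧ j <_) (sym (trans (length-map toℕ (toList w)) (Vec.length-toList w))) (⟦⟧<n w j j<n))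
  (proj₂ (inv j j<n))
  (λ q q<wj wq≡j → <-irrefl (trans (sym (proj₂ (inv q (<-trans q<wj (proj₁ (inv j j<n)))))) (cong ⟦ w ⟧ wq≡j)) q<wj)
  where inv = IsInvolution⇒Involution w w-inv

length-filter-applyUpTo : ∀ {A : Set} {P : A → Set} (P? : ∀ x → Dec (P x)) (f : ℕ → A) n →
                          length (filter P? (applyUpTo f n)) ≡ count (λ j → does (P? (f j))) n
length-filter-applyUpTo P? f zero = refl
length-filter-applyUpTo P? f (suc n) with does (P? (f 0))
... | true  = cong suc (length-filter-applyUpTo P? (f ∘ suc) n)
... | false = length-filter-applyUpTo P? (f ∘ suc) n

applyUpTo-congᴸ : ∀ {A : Set} {f g : ℕ → A} n → (∀ i → i < n → f i ≡ g i) → applyUpTo f n ≡ applyUpTo g n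
applyUpTo-congᴸ zero    _   = refl
applyUpTo-congᴸ (suc n) f≡g = cong₂ _∷_ (f≡g 0 z<s) (applyUpTo-congᴸ n (λ i i<n → f≡g (suc i) (s<s i<n)))

applyUpTo-injective : ∀ {A : Set} {f g : ℕ → A} n → applyUpTo f n ≡ applyUpTo g n → ∀ i → i < n → f i ≡ g i
applyUpTo-injective (suc n) eq zero    _         = ∷-injectiveˡ eq
applyUpTo-injective (suc n) eq (suc i) (s≤s i<n) = applyUpTo-injective n (∷-injectiveʳ eq) i i<n

I≡code : ∀ {n} (w : Word n) → IsInvolution w → I w ≡ applyUpTo (code ⟦ w ⟧) n
I≡code {n} w w-inv = trans (map-upTo _ n) (applyUpTo-congᴸ n λ i i<n →
  trans (length-filter-applyUpTo (λ j → winv w i <? winv w j) (λ j → j) i)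
    (count-cong i (λ j j<i → cong₂ (λ x y → does (x <? y)) (winv≡⟦⟧ w w-inv i i<n) (winv≡⟦⟧ w w-inv j (<-trans j<i i<n)))))

Pointwise-applyUpTo⁻ : ∀ {f g : ℕ → ℕ} n → Pointwise _≤_ (applyUpTo f n) (applyUpTo g n) → ∀ i → i < n → f i ≤ g i
Pointwise-applyUpTo⁻ (suc n) (f0≤g0 ∷ _)  zero    _         = f0≤g0
Pointwise-applyUpTo⁻ (suc n) (_ ∷ f≤g)    (suc i) (s≤s i<n) = Pointwise-applyUpTo⁻ n f≤g i i<n

Pointwise-applyUpTo⁺ : ∀ {f g : ℕ → ℕ} n → (∀ i → i < n → f i ≤ g i) → Pointwise _≤_ (applyUpTo f n) (applyUpTo g n)
Pointwise-applyUpTo⁺ zero    _   = []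
Pointwise-applyUpTo⁺ (suc n) f≤g = f≤g 0 z<s ∷ Pointwise-applyUpTo⁺ n (λ i i<n → f≤g (suc i) (s<s i<n))

¬LargeAscent⇒ : ∀ {x y} → ¬ LargeAscent x y → y ≤ x ⊎ y ≡ suc x
¬LargeAscent⇒ {x} {y} ¬large with x <? y
... | no  x≮y = inj₁ (≮⇒≥ x≮y)
... | yes x<y with y ≟ suc x
...   | yes y≡1+x = inj₂ y≡1+x
...   | no  y≢1+x = ⊥-elim (¬large (x<y , y≢1+x))

⇒¬LargeAscent : ∀ {x y} → y ≤ x ⊎ y ≡ suc x → ¬ LargeAscent x y
⇒¬LargeAscent (inj₁ y≤x)   (x<y , _)     = <⇒≱ x<y y≤x
⇒¬LargeAscent (inj₂ y≡1+x) (_ , y≢1+x)   = y≢1+x y≡1+x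

SlowClimbing⇒NoLargeAscent : ∀ {c} n → SlowClimbing (applyUpTo c n) → NoLargeAscent n c
SlowClimbing⇒NoLargeAscent (suc zero)    _             zero    (s≤s ())
SlowClimbing⇒NoLargeAscent (suc (suc n)) (¬large , _)  zero    _           = ¬LargeAscent⇒ ¬large
SlowClimbing⇒NoLargeAscent {c} (suc (suc n)) (_ , slow) (suc j) (s≤s 2+j<n) =
  SlowClimbing⇒NoLargeAscent {c ∘ suc} (suc n) slow j 2+j<n

NoLargeAscent⇒SlowClimbing : ∀ {c} n → NoLargeAscent n c → SlowClimbing (applyUpTo c n)
NoLargeAscent⇒SlowClimbing zero                _       = tt
NoLargeAscent⇒SlowClimbing (suc zero)          _       = tt
NoLargeAscent⇒SlowClimbing {c} (suc (suc n)) noLarge =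
  ⇒¬LargeAscent (noLarge 0 (s<s z<s)) , NoLargeAscent⇒SlowClimbing {c ∘ suc} (suc n) (λ j 2+j<n → noLarge (suc j) (s<s 2+j<n))

slowClimbing? : ∀ xs → Dec (SlowClimbing xs)
slowClimbing? []           = yes tt
slowClimbing? (x ∷ [])     = yes tt
slowClimbing? (x ∷ y ∷ xs) = ¬? ((x <? y) ×-dec ¬? (y ≟ suc x)) ×-dec slowClimbing? (y ∷ xs)

nonzeros-applyUpTo : ∀ c n → nonzeros (applyUpTo c n) ≡ count (isNonzero ∘ c) n
nonzeros-applyUpTo c n = trans (length-filter-applyUpTo (λ x → ¬? (x ≟ 0)) c n) (count-cong n (λ j _ → nonzero≡ (c j)))
  where
  nonzero≡ : ∀ x → does (¬? (x ≟ 0)) ≡ isNonzero x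
  nonzero≡ zero    = refl
  nonzero≡ (suc x) = refl

⟦e⟧ : ∀ n i → i < n → ⟦ e n ⟧ i ≡ i
⟦e⟧ n i i<n = trans (atℕ-lookup (e n) i i<n) (trans (cong toℕ (Vec.lookup∘tabulate (λ z → z) (fromℕ< i<n))) (toℕ-fromℕ< i<n))

e-isInvolution : ∀ n → IsInvolution (e n)
e-isInvolution n i = trans (Vec.lookup∘tabulate (λ z → z) (lookup (e n) i)) (Vec.lookup∘tabulate (λ z → z) i)

I-e : ∀ n → I (e n) ≡ applyUpTo (λ _ → 0) n
I-e n = trans (I≡code (e n) (e-isInvolution n)) (applyUpTo-congᴸ n λ i i<n → count-none _ i λ j j<i →
  dec-false (⟦ e n ⟧ i <? ⟦ e n ⟧ j) (<⇒≯ (subst₂ _<_ (sym (⟦e⟧ n j (<-trans j<i i<n))) (sym (⟦e⟧ n i i<n)) j<i)))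

-- positions i with f i ≥ n get the junk value i
clampFin : ∀ {n} → ℕ → Fin n → Fin n
clampFin {n} x default with x <? n
... | yes x<n = fromℕ< x<n
... | no  _   = default

toℕ-clampFin : ∀ {n} x (default : Fin n) → x < n → toℕ (clampFin x default) ≡ x
toℕ-clampFin {n} x _ x<n with x <? n
... | yes x<n = toℕ-fromℕ< x<n
... | no  x≮n = ⊥-elim (x≮n x<n)

fromFun : ∀ {n} → (ℕ → ℕ) → Word n
fromFun f = tabulate (λ i → clampFin (f (toℕ i)) i)

⟦fromFun⟧ : ∀ {n} (f : ℕ → ℕ) i → i < n → f i < n → ⟦ fromFun {n} f ⟧ i ≡ f i
⟦fromFun⟧ {n} f i i<n fi<n = begin
  ⟦ fromFun {n} f ⟧ i                                     ≡⟨ atℕ-lookup (fromFun {n} f) i i<n ⟩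
  toℕ (lookup (fromFun {n} f) (fromℕ< i<n))                 ≡⟨ cong toℕ (Vec.lookup∘tabulate _ (fromℕ< i<n)) ⟩
  toℕ (clampFin (f (toℕ (fromℕ< i<n))) (fromℕ< i<n))      ≡⟨ cong (λ j → toℕ (clampFin (f j) (fromℕ< i<n))) (toℕ-fromℕ< i<n) ⟩
  toℕ (clampFin (f i) (fromℕ< i<n))                        ≡⟨ toℕ-clampFin (f i) _ fi<n ⟩
  f i                                                      ∎
  where open ≡-Reasoning

⟦fromFun⟧-involution : ∀ {n f} → Involution n f → ∀ i → i < n → ⟦ fromFun {n} f ⟧ i ≡ f i
⟦fromFun⟧-involution {f = f} inv i i<n = ⟦fromFun⟧ f i i<n (proj₁ (inv i i<n))

fromFun-isInvolution : ∀ {n f} → Involution n f → IsInvolution (fromFun {n} f)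
fromFun-isInvolution {n} {f} inv i = toℕ-injective (begin
  toℕ (lookup w (lookup w i))     ≡⟨ ⟦⟧-toℕ w (lookup w i) ⟨
  ⟦ w ⟧ (toℕ (lookup w i))        ≡⟨ cong ⟦ w ⟧ (⟦⟧-toℕ w i) ⟨
  ⟦ w ⟧ (⟦ w ⟧ (toℕ i))           ≡⟨ cong ⟦ w ⟧ (⟦fromFun⟧-involution inv (toℕ i) (toℕ<n i)) ⟩
  ⟦ w ⟧ (f (toℕ i))               ≡⟨ ⟦fromFun⟧-involution inv (f (toℕ i)) (proj₁ (inv (toℕ i) (toℕ<n i))) ⟩
  f (f (toℕ i))                   ≡⟨ proj₂ (inv (toℕ i) (toℕ<n i)) ⟩
  toℕ i                           ∎)
  where
  open ≡-Reasoning
  w = fromFun {n} f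

allWords-complete : ∀ {n k} (v : Vec (Fin n) k) → v ∈ allWords n k
allWords-complete [] = here refl
allWords-complete {n} (x ∷ v) = ∈-concatMap⁺ (λ u → map (_∷ u) (allFin n))
  (Any.map (λ { refl → ∈-map⁺ (_∷ v) (∈-allFin x) }) (allWords-complete v))

allWords-unique : ∀ n k → Unique (allWords n k)
allWords-unique n zero    = [] ∷ []
allWords-unique n (suc k) = Unique.concat⁺ (blocksUnique (allWords n k))
  (AllPairs.map⁺ (AllPairs.map blocksDisjoint (allWords-unique n k)))
  where
  block : Vec (Fin n) k → List (Vec (Fin n) (suc k))
  block v = map (_∷ v) (allFin n)
  blocksUnique : ∀ vs → All Unique (map block vs)
  blocksUnique []       = []
  blocksUnique (v ∷ vs) = Unique.map⁺ Vec.∷-injectiveˡ (Unique.allFin⁺ n) ∷ blocksUnique vs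
  blocksDisjoint : ∀ {v w} → v ≢ w → Disjoint (block v) (block w)
  blocksDisjoint {v} {w} v≢w (x∈ , y∈) with _ , _ , refl ← ∈-map⁻ (_∷ v) x∈ | _ , _ , eq ← ∈-map⁻ (_∷ w) y∈
    = v≢w (Vec.∷-injectiveʳ eq)

involutions-unique : ∀ n → Unique (involutions n)
involutions-unique n = Unique.filter⁺ isInvolution? (allWords-unique n n)

∈-involutions : ∀ {n} (w : Word n) → IsInvolution w → w ∈ involutions n
∈-involutions w w-inv = ∈-filter⁺ isInvolution? (allWords-complete w) w-inv

∈-involutions⁻ : ∀ {n} {w : Word n} → w ∈ involutions n → IsInvolution w
∈-involutions⁻ {n} w∈ = proj₂ (∈-filter⁻ isInvolution? {xs = allWords n n} w∈)

-- The involution poset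

lastNonzero : ∀ (c : ℕ → ℕ) n →
  (∀ j → j < n → c j ≡ 0) ⊎ ∃ λ k → k < n × c k ≢ 0 × (∀ j → k < j → j < n → c j ≡ 0)
lastNonzero c zero = inj₁ (λ _ ())
lastNonzero c (suc n) with c n ≟ 0 | lastNonzero c n
... | no cn≢0 | _ = inj₂ (n , ≤-refl , cn≢0 , λ j n<j j<1+n → ⊥-elim (<⇒≱ n<j (≤-pred j<1+n)))
... | yes cn≡0 | inj₁ zeros = inj₁ λ j j<1+n → case m≤n⇒m<n∨m≡n (≤-pred j<1+n) of λ where
  (inj₁ j<n)  → zeros j j<n
  (inj₂ refl) → cn≡0
... | yes cn≡0 | inj₂ (k , k<n , ck≢0 , zeros) = inj₂ (k , m<n⇒m<1+n k<n , ck≢0 , λ j k<j j<1+n →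
  case m≤n⇒m<n∨m≡n (≤-pred j<1+n) of λ where
    (inj₁ j<n)  → zeros j k<j j<n
    (inj₂ refl) → cn≡0)

module InvolutionPoset (n : ℕ) where

  _≟W_ : DecidableEquality (Word n)
  _≟W_ = Vec.≡-dec _≟F_

  ≼⇒code≤ : ∀ (s t : Word n) → IsInvolution s → IsInvolution t → s ≼ t → ∀ i → i < n → code ⟦ s ⟧ i ≤ code ⟦ t ⟧ i
  ≼⇒code≤ s t s-inv t-inv s≼t = Pointwise-applyUpTo⁻ n (subst₂ (Pointwise _≤_) (I≡code s s-inv) (I≡code t t-inv) s≼t)

  code≤⇒≼ : ∀ (s t : Word n) → IsInvolution s → IsInvolution t → (∀ i → i < n → code ⟦ s ⟧ i ≤ code ⟦ t ⟧ i) → s ≼ t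
  code≤⇒≼ s t s-inv t-inv s≤t =
    subst₂ (Pointwise _≤_) (sym (I≡code s s-inv)) (sym (I≡code t t-inv)) (Pointwise-applyUpTo⁺ n s≤t)

  code≡⇒≡ : ∀ (s t : Word n) → IsInvolution s → IsInvolution t → (∀ i → i < n → code ⟦ s ⟧ i ≡ code ⟦ t ⟧ i) → s ≡ t
  code≡⇒≡ s t s-inv t-inv s≡t = ⟦⟧-injective s t
    (code-injective (IsInvolution⇒Involution s s-inv) (IsInvolution⇒Involution t t-inv) s≡t)

  ≼-refl : ∀ (s : Word n) → IsInvolution s → s ≼ s
  ≼-refl s s-inv = code≤⇒≼ s s s-inv s-inv (λ _ _ → ≤-refl)

  ≼-trans : ∀ (s t v : Word n) → IsInvolution s → IsInvolution t → IsInvolution v → s ≼ t → t ≼ v → s ≼ v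
  ≼-trans s t v s-inv t-inv v-inv s≼t t≼v = code≤⇒≼ s v s-inv v-inv (λ i i<n →
    ≤-trans (≼⇒code≤ s t s-inv t-inv s≼t i i<n) (≼⇒code≤ t v t-inv v-inv t≼v i i<n))

  ≼-antisym : ∀ (s t : Word n) → IsInvolution s → IsInvolution t → s ≼ t → t ≼ s → s ≡ t
  ≼-antisym s t s-inv t-inv s≼t t≼s = code≡⇒≡ s t s-inv t-inv (λ i i<n →
    ≤-antisym (≼⇒code≤ s t s-inv t-inv s≼t i i<n) (≼⇒code≤ t s t-inv s-inv t≼s i i<n))

  code-e : ∀ i → i < n → code ⟦ e n ⟧ i ≡ 0
  code-e = applyUpTo-injective n (trans (sym (I≡code (e n) (e-isInvolution n))) (I-e n))

  e-≼ : ∀ (t : Word n) → IsInvolution t → e n ≼ t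
  e-≼ t t-inv = code≤⇒≼ (e n) t (e-isInvolution n) t-inv (λ i i<n → subst (_≤ code ⟦ t ⟧ i) (sym (code-e i i<n)) z≤n)

  code-fromFun : ∀ {f} → Involution n f → ∀ i → i < n → code ⟦ fromFun {n} f ⟧ i ≡ code f i
  code-fromFun inv i i<n = code-cong _ _ i (λ j j≤i → ⟦fromFun⟧-involution inv j (≤-<-trans j≤i i<n))

  I-fromFun : ∀ {f} → Involution n f → I (fromFun {n} f) ≡ applyUpTo (code f) n
  I-fromFun {f} inv = trans (I≡code (fromFun f) (fromFun-isInvolution inv)) (applyUpTo-congᴸ n (code-fromFun inv))

  μ-formula : Word n → ℤ
  μ-formula w = if does (slowClimbing? (I w)) then -1ℤ ^ nonzeros (I w) else 0ℤ

  μ-formula-slow : ∀ {w} → SlowClimbing (I w) → μ-formula w ≡ -1ℤ ^ nonzeros (I w)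
  μ-formula-slow {w} slow = cong (λ b → if b then -1ℤ ^ nonzeros (I w) else 0ℤ) (dec-true (slowClimbing? (I w)) slow)

  μ-formula-notSlow : ∀ {w} → ¬ SlowClimbing (I w) → μ-formula w ≡ 0ℤ
  μ-formula-notSlow {w} ¬slow = cong (λ b → if b then -1ℤ ^ nonzeros (I w) else 0ℤ) (dec-false (slowClimbing? (I w)) ¬slow)

  μ-formula-e : μ-formula (e n) ≡ 1ℤ
  μ-formula-e = trans (μ-formula-slow {e n} (subst SlowClimbing (sym (I-e n)) zerosSlow))
    (cong (-1ℤ ^_) (trans (cong nonzeros (I-e n)) (trans (nonzeros-applyUpTo _ n) (count-none _ n (λ _ _ → refl)))))
    where
    zerosSlow : SlowClimbing (applyUpTo (λ _ → 0) n)
    zerosSlow = NoLargeAscent⇒SlowClimbing n (λ _ _ → inj₁ z≤n)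

  nonzeros-I : ∀ (t : Word n) → IsInvolution t → nonzeros (I t) ≡ count (isNonzero ∘ code ⟦ t ⟧) n
  nonzeros-I t t-inv = trans (cong nonzeros (I≡code t t-inv)) (nonzeros-applyUpTo (code ⟦ t ⟧) n)

  nonzeros-I-fromFun : ∀ {f} → Involution n f → nonzeros (I (fromFun {n} f)) ≡ count (isNonzero ∘ code f) n
  nonzeros-I-fromFun {f} inv = trans (cong nonzeros (I-fromFun inv)) (nonzeros-applyUpTo (code f) n)

  interval : Word n → List (Word n)
  interval u = filter (λ t → (e n ≼? t) ×-dec (t ≼? u)) (involutions n)

  module IntervalSum (u : Word n) (u-inv : IsInvolution u) {K} (k<n : suc K < n)
                     (codeu≢0 : code ⟦ u ⟧ (suc K) ≢ 0)
                     (codeu≡0 : ∀ j → suc K < j → j < n → code ⟦ u ⟧ j ≡ 0) where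

    open Toggle (IsInvolution⇒Involution u u-inv) k<n (n≢0⇒n>0 codeu≢0) codeu≡0

    Below : Word n → Set
    Below t = IsInvolution t × t ≼ u × SlowClimbing (I t)

    below? : ∀ t → Dec (Below t)
    below? t = isInvolution? t ×-dec (t ≼? u) ×-dec slowClimbing? (I t)

    Below⇒Admissible : ∀ {t} → Below t → Admissible n ⟦ u ⟧ ⟦ t ⟧
    Below⇒Admissible {t} (t-inv , t≼u , slow) = record
      { involution    = IsInvolution⇒Involution t t-inv
      ; dominated     = ≼⇒code≤ t u t-inv u-inv t≼u
      ; noLargeAscent = SlowClimbing⇒NoLargeAscent n (subst SlowClimbing (I≡code t t-inv) slow)
      }

    Admissible⇒Below : ∀ {f} → Admissible n ⟦ u ⟧ f → Below (fromFun f)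
    Admissible⇒Below {f} adm =
        fromFun-isInvolution involution
      , code≤⇒≼ (fromFun f) u (fromFun-isInvolution involution) u-inv (λ i i<n →
          subst (_≤ code ⟦ u ⟧ i) (sym (code-fromFun involution i i<n)) (dominated i i<n))
      , subst SlowClimbing (sym (I-fromFun involution)) (NoLargeAscent⇒SlowClimbing n noLargeAscent)
      where open Admissible adm

    τ : Word n → Word n
    τ t = if does (below? t) then fromFun (toggle ⟦ t ⟧) else t

    τ-below : ∀ {t} → Below t → τ t ≡ fromFun (toggle ⟦ t ⟧)
    τ-below {t} b = cong (λ x → if x then fromFun (toggle ⟦ t ⟧) else t) (dec-true (below? t) b)

    τ-notBelow : ∀ {t} → ¬ Below t → τ t ≡ t
    τ-notBelow {t} ¬b = cong (λ x → if x then fromFun (toggle ⟦ t ⟧) else t) (dec-false (below? t) ¬b)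

    τ-involutive : ∀ t → τ (τ t) ≡ t
    τ-involutive t = by (below? t)
      where
      by : Dec (Below t) → τ (τ t) ≡ t
      by (no ¬b) = trans (cong τ (τ-notBelow {t} ¬b)) (τ-notBelow {t} ¬b)
      by (yes b) = begin
        τ (τ t)                  ≡⟨ cong τ (τ-below {t} b) ⟩
        τ w                      ≡⟨ τ-below {w} b' ⟩
        fromFun (toggle ⟦ w ⟧)   ≡⟨ ⟦⟧-injective (fromFun (toggle ⟦ w ⟧)) t (λ i i<n →
                                      trans (⟦fromFun⟧-involution (Admissible.involution adm'') i i<n)
                                            (toggle-involutive adm ⟦ w ⟧ (⟦fromFun⟧-involution involution') i i<n)) ⟩
        t                        ∎
        where
        open ≡-Reasoning
        adm = Below⇒Admissible {t} b
        involution' = Admissible.involution (toggle-admissible adm)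
        w  = fromFun (toggle ⟦ t ⟧)
        b' = Admissible⇒Below (toggle-admissible adm)
        adm'' = toggle-admissible (Below⇒Admissible {w} b')

    τ-interval : ∀ {t} → t ∈ interval u → τ t ∈ interval u
    τ-interval {t} t∈ = by (below? t)
      where
      by : Dec (Below t) → τ t ∈ interval u
      by (no ¬b) = subst (_∈ interval u) (sym (τ-notBelow {t} ¬b)) t∈
      by (yes b) = subst (_∈ interval u) (sym (τ-below {t} b))
        (∈-filter⁺ (λ t → (e n ≼? t) ×-dec (t ≼? u)) (∈-involutions w w-inv) (e-≼ w w-inv , w≼u))
        where
        w = fromFun (toggle ⟦ t ⟧)
        b' = Admissible⇒Below (toggle-admissible (Below⇒Admissible {t} b))
        w-inv = proj₁ b'
        w≼u = proj₁ (proj₂ b')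

    μ-formula-τ : ∀ {t} → t ∈ interval u → μ-formula (τ t) ≡ - μ-formula t
    μ-formula-τ {t} t∈ = by (below? t)
      where
      by : Dec (Below t) → μ-formula (τ t) ≡ - μ-formula t
      by (yes b@(t-inv , _ , slow)) = begin
        μ-formula (τ t)                  ≡⟨ cong μ-formula (τ-below {t} b) ⟩
        μ-formula (fromFun {n} g)        ≡⟨ μ-formula-slow {fromFun {n} g} (proj₂ (proj₂ (Admissible⇒Below adm'))) ⟩
        -1ℤ ^ nonzeros (I (fromFun {n} g)) ≡⟨ cong (-1ℤ ^_) (nonzeros-I-fromFun (Admissible.involution adm')) ⟩
        -1ℤ ^ nonzeroCount g             ≡⟨ toggle-sign adm ⟩
        - (-1ℤ ^ nonzeroCount ⟦ t ⟧)     ≡⟨ cong (λ m → - (-1ℤ ^ m)) (nonzeros-I t t-inv) ⟨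
        - (-1ℤ ^ nonzeros (I t))         ≡⟨ cong -_ (μ-formula-slow {t} slow) ⟨
        - μ-formula t                    ∎
        where
        open ≡-Reasoning
        adm = Below⇒Admissible {t} b
        g = toggle ⟦ t ⟧
        adm' = toggle-admissible adm
      by (no ¬b) = trans (cong μ-formula (τ-notBelow {t} ¬b)) (trans μ-formula≡0 (cong -_ (sym μ-formula≡0)))
        where
        t∈' = ∈-filter⁻ (λ t → (e n ≼? t) ×-dec (t ≼? u)) {xs = involutions n} t∈
        μ-formula≡0 : μ-formula t ≡ 0ℤ
        μ-formula≡0 = μ-formula-notSlow {t} λ slow → ¬b (∈-involutions⁻ (proj₁ t∈') , proj₂ (proj₂ t∈') , slow)

    sum-interval≡0 : sumℤ (map μ-formula (interval u)) ≡ 0ℤ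
    sum-interval≡0 = sumℤ-signReversing≡0 τ μ-formula
      (Unique.filter⁺ (λ t → (e n ≼? t) ×-dec (t ≼? u)) (involutions-unique n)) τ-involutive τ-interval μ-formula-τ

  interval-sum : ∀ {u} → u ∈ involutions n → e n ≼ u → e n ≢ u → sumℤ (map μ-formula (interval u)) ≡ 0ℤ
  interval-sum {u} u∈ _ e≢u = fromLastNonzero (lastNonzero (code ⟦ u ⟧) n)
    where
    u-inv = ∈-involutions⁻ u∈
    fromLastNonzero : (∀ j → j < n → code ⟦ u ⟧ j ≡ 0) ⊎ ∃ (λ k → k < n × code ⟦ u ⟧ k ≢ 0 × (∀ j → k < j → j < n → code ⟦ u ⟧ j ≡ 0)) →
          sumℤ (map μ-formula (interval u)) ≡ 0ℤ
    fromLastNonzero (inj₁ zeros) = ⊥-elim (e≢u (code≡⇒≡ (e n) u (e-isInvolution n) u-inv (λ i i<n →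
      trans (code-e i i<n) (sym (zeros i i<n)))))
    fromLastNonzero (inj₂ (zero  , _   , code0≢0  , _))       = ⊥-elim (code0≢0 refl)
    fromLastNonzero (inj₂ (suc K , k<n , codeu≢0 , codeu≡0)) = IntervalSum.sum-interval≡0 u u-inv k<n codeu≢0 codeu≡0

  μI≡μ-formula : ∀ (w : Word n) → IsInvolution w → μI n (e n) w ≡ μ-formula w
  μI≡μ-formula w w-inv = MobiusCharacterisation.mobius≡ (involutions n) _≟W_ _≼_ _≼?_ (involutions-unique n)
    (λ {x} x∈ → ≼-refl x (∈-involutions⁻ x∈))
    (λ {x} {y} {z} x∈ y∈ z∈ → ≼-trans x y z (∈-involutions⁻ x∈) (∈-involutions⁻ y∈) (∈-involutions⁻ z∈))
    (λ {x} {y} x∈ y∈ → ≼-antisym x y (∈-involutions⁻ x∈) (∈-involutions⁻ y∈))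
    (e n) μ-formula μ-formula-e interval-sum (∈-involutions w w-inv) (e-≼ w w-inv)

theorem5p6 : (n : ℕ) (w : Word n) → IsInvolution w →
    (SlowClimbing (I w) → μI n (e n) w ≡ -1ℤ ^ nonzeros (I w)) ×
    (¬ SlowClimbing (I w) → μI n (e n) w ≡ 0ℤ)
theorem5p6 n w w-inv =
    (λ slow → trans (μI≡μ-formula w w-inv) (μ-formula-slow {w} slow))
  , (λ ¬slow → trans (μI≡μ-formula w w-inv) (μ-formula-notSlow {w} ¬slow))
  where open InvolutionPoset n
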